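{- Let $p$ be a prime with $p\equiv 1 \pmod 8$, write $p-1=2^e m$ with $m$ odd, and let $a\in\mathbb{F}_p$ be a nonzero quadratic residue. Let $E$ be the singular cubic $y^2=x(x+a)^2$ over $\mathbb{F}_p$ and $E(\mathbb{F}_p)$ its group of nonsingular $\mathbb{F}_p$-points together with $\infty$ (a cyclic group of order $p-1$). If $R$ is chosen uniformly at random from $E(\mathbb{F}_p)$, then the probability that $2^i mR$ is a point of order $4$ for some integer $i$ with $0\le i< e-1$ equals $1-\dfrac{1}{2^{e-1}}$.
   Context: The point $(-a,0)$ is the unique singular point of $E$. $E(\mathbb{F}_p)$ denotes the set of all $(x,y)\in\mathbb{F}_p^2$ with $y^2=x(x+a)^2$ and $(x,y)\neq(-a,0)$, together with a point at infinity $\infty$, with the chord-and-tangent group law: $\infty$ is the identity, $-(x,y)=(x,-y)$; for $x_1\neq x_2$, $(x_1,y_1)+(x_2,y_2)=(x_3,y_3)$ with $k=(y_2-y_1)/(x_2-x_1)$, $x_3=k^2-2a-x_1-x_2$, $y_3=k(x_1-x_3)-y_1$; points with equal $x$ and opposite $y$ sum to $\infty$; for $y_1\neq0$, $2(x_1,y_1)=(x_3,y_3)$ with $k=(x_1+a)(3x_1+a)/(2y_1)$, $x_3=k^2-2a-2x_1$, $y_3=k(x_1-x_3)-y_1$. -}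

module Defs where

open import Data.Nat using (ℕ; zero; suc; _+_; _*_; _∸_; _^_; _<_; NonZero)
open import Data.Nat.Properties using (_≟_; _<?_; allUpTo?; anyUpTo?)
open import Data.Nat.DivMod using (_%_)
open import Data.List using (List; []; _∷_; filter; length; concatMap; map; upTo)
open import Data.Product using (_×_; _,_; ∃)
open import Relation.Nullary using (Dec; yes; no; ¬_; ¬?)
open import Relation.Nullary.Decidable using (_×-dec_; _→-dec_)
open import Relation.Binary.PropositionalEquality using (_≡_; _≢_; refl; cong)
open import Relation.Binary.Definitions using (DecidableEquality)
open import Data.Bool using (if_then_else_)
open import Relation.Nullary.Decidable using (⌊_⌋)

-- Points of the (affine + infinity) plane: ∞, or (x , y) with x y ∈ 𝔽_p
-- represented by their residues in {0, …, p-1}.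
data Pt : Set where
  ∞   : Pt
  aff : ℕ → ℕ → Pt

aff-inj₁ : ∀ {x y x' y'} → aff x y ≡ aff x' y' → x ≡ x'
aff-inj₁ refl = refl

aff-inj₂ : ∀ {x y x' y'} → aff x y ≡ aff x' y' → y ≡ y'
aff-inj₂ refl = refl

_≟Pt_ : DecidableEquality Pt
∞ ≟Pt ∞ = yes refl
∞ ≟Pt aff _ _ = no λ ()
aff _ _ ≟Pt ∞ = no λ ()
aff x y ≟Pt aff x' y' with x ≟ x' | y ≟ y'
... | yes refl | yes refl = yes refl
... | no ne | _ = no λ e → ne (aff-inj₁ e)
... | _ | no ne = no λ e → ne (aff-inj₂ e)

module Curve (p : ℕ) .{{_ : NonZero p}} (a : ℕ) where

  _⊕_ : ℕ → ℕ → ℕ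
  x ⊕ y = (x + y) % p

  _⊗_ : ℕ → ℕ → ℕ
  x ⊗ y = (x * y) % p

  neg : ℕ → ℕ
  neg x = (p ∸ (x % p)) % p

  _⊖_ : ℕ → ℕ → ℕ
  x ⊖ y = x ⊕ neg y

  -- multiplicative inverse in 𝔽_p (p prime): x⁻¹ = x^(p-2) (Fermat)
  inv : ℕ → ℕ
  inv x = ((x % p) ^ (p ∸ 2)) % p

  _⊘_ : ℕ → ℕ → ℕ
  x ⊘ y = x ⊗ inv y

  OnCurve : ℕ → ℕ → Set
  OnCurve x y = (y ⊗ y) ≡ (x ⊗ ((x ⊕ a) ⊗ (x ⊕ a)))

  Singular : ℕ → ℕ → Set
  Singular x y = aff x y ≡ aff (neg a) 0

  affinePts : List Pt
  affinePts = filter (λ P → good? P)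
                (concatMap (λ x → map (λ y → aff x y) (upTo p)) (upTo p))
    where
    good? : (P : Pt) → Dec (∃ λ x → ∃ λ y → P ≡ aff x y × OnCurve x y × ¬ Singular x y)
    good? ∞ = no λ { (_ , _ , () , _) }
    good? (aff x y) with (y ⊗ y) ≟ (x ⊗ ((x ⊕ a) ⊗ (x ⊕ a))) | aff x y ≟Pt aff (neg a) 0
    ... | yes oc | no ns = yes (x , y , refl , oc , ns)
    ... | no noc | _ = no λ { (_ , _ , refl , oc , _) → noc oc }
    ... | yes _ | yes s = no λ { (_ , _ , refl , _ , ns) → ns s }

  E : List Pt
  E = ∞ ∷ affinePts

  _+E_ : Pt → Pt → Pt
  ∞ +E Q = Q
  P +E ∞ = P
  aff x₁ y₁ +E aff x₂ y₂ with (x₁ % p) ≟ (x₂ % p)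
  ... | no _ =
    let k  = (y₂ ⊖ y₁) ⊘ (x₂ ⊖ x₁)
        x₃ = (((k ⊗ k) ⊖ (2 ⊗ a)) ⊖ x₁) ⊖ x₂
        y₃ = (k ⊗ (x₁ ⊖ x₃)) ⊖ y₁
    in aff x₃ y₃
  ... | yes _ with (y₁ ⊕ y₂) ≟ 0
  ...   | yes _ = ∞
  ...   | no _ =                         -- doubling (y₁ = y₂ ≠ 0)
    let k  = ((x₁ ⊕ a) ⊗ ((3 ⊗ x₁) ⊕ a)) ⊘ (2 ⊗ y₁)
        x₃ = ((k ⊗ k) ⊖ (2 ⊗ a)) ⊖ (2 ⊗ x₁)
        y₃ = (k ⊗ (x₁ ⊖ x₃)) ⊖ y₁
    in aff x₃ y₃

  _·_ : ℕ → Pt → Pt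
  zero  · P = ∞
  suc n · P = P +E (n · P)

  HasOrder : Pt → ℕ → Set
  HasOrder P n = (0 < n) × (n · P ≡ ∞) × (∀ {k} → k < n → 0 < k → ¬ (k · P ≡ ∞))

  hasOrder? : (P : Pt) (n : ℕ) → Dec (HasOrder P n)
  hasOrder? P n = (0 <? n) ×-dec ((n · P) ≟Pt ∞)
                    ×-dec allUpTo? (λ k → (0 <? k) →-dec ¬? ((k · P) ≟Pt ∞)) n

  Event : (e m : ℕ) → Pt → Set
  Event e m R = ∃ λ i → i < e ∸ 1 × HasOrder (((2 ^ i) * m) · R) 4

  event? : (e m : ℕ) (R : Pt) → Dec (Event e m R)
  event? e m R = anyUpTo? (λ i → hasOrder? (((2 ^ i) * m) · R) 4) (e ∸ 1)

  countEvent : (e m : ℕ) → ℕ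
  countEvent e m = length (filter (event? e m) E)

module Submission where

open import Defs
open import Data.Nat using (ℕ; zero; suc; _+_; _*_; _∸_; _^_; _<_; _≤_; z≤n; s≤s; z<s; _≟_; NonZero; nonTrivial⇒n>1)
import Data.Nat.Properties as ℕ
open import Data.Nat.DivMod using (_%_; _/_; m%n%n≡m%n; m<n⇒m%n≡m; m%n<n; m≡m%n+[m/n]*n; [m+kn]%n≡m%n; m*n%n≡0)
open import Data.Nat.Divisibility using (m%n≡0⇒n∣m; n∣m⇒m%n≡0) renaming (_∣_ to _∣ℕ_)
open import Data.Nat.Primality using (Prime; euclidsLemma; prime⇒nonTrivial; ¬prime[0]; ¬prime[1])
open import Data.Nat.Tactic.RingSolver using () renaming (solve-∀ to ℕ-solve-∀)
open import Data.Integer as ℤ using (ℤ; +_; -[1+_]; 0ℤ; 1ℤ)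
import Data.Integer.Properties as ℤ
open import Data.Integer.Divisibility.Signed using (_∣_; divides; ∣m⇒∣-m; ∣m∣n⇒∣m+n; ∣m⇒∣m*n; ∣n⇒∣m*n)
open import Data.Integer.Tactic.RingSolver using () renaming (solve-∀ to ℤ-solve-∀)
open import Data.Integer.Solver using (module +-*-Solver)
open +-*-Solver using (Polynomial; op; con; var; _:^_; :-_; prove; _:=_; _:+_; _:*_; _:-_; ⟦_⟧; ⟦_⟧↓)
open import Algebra.Solver.Ring using ([+]; [*])
open import Data.List using (List; []; _∷_; _++_; [_]; length; filter; map; concatMap; upTo; replicate)
open import Data.List.Properties using (length-++; length-map; length-upTo; length-replicate; filter-all)
open import Data.List.Membership.Propositional using (_∈_; find)
open import Data.List.Membership.Propositional.Properties
  using (∈-∃++; ∈-++⁻; ∈-++⁺ˡ; ∈-++⁺ʳ; ∈-map⁺; ∈-map⁻; ∈-upTo⁺; ∈-upTo⁻; ∈-filter⁺; ∈-filter⁻; ∈-concatMap⁺; ∈-concatMap⁻)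
open import Data.List.Relation.Binary.Subset.Propositional using (_⊆_)
open import Data.List.Relation.Unary.Any as Any using (here; there)
open import Data.List.Relation.Unary.All as All using (All)
open import Data.List.Relation.Unary.All.Properties as All using (¬All⇒Any¬)
open import Data.List.Relation.Unary.AllPairs using ([]; _∷_)
open import Data.List.Relation.Unary.Unique.Propositional using (Unique)
import Data.List.Relation.Unary.Unique.Propositional.Properties as Unique
open import Data.List.Relation.Binary.Permutation.Propositional as ↭ using (_↭_; prep; swap; ↭-sym; ↭-trans; ↭-refl)
open import Data.List.Relation.Binary.Permutation.Propositional.Properties using (shift; ↭-length; filter-↭)
open import Data.Vec as Vec using (Vec; lookup; []; _∷_)
import Data.Vec.Properties as Vec
open import Data.Vec.N-ary using (N-ary; _$ⁿ_)
open import Data.Product using (_×_; _,_; ∃; proj₁; proj₂)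
open import Data.Sum as Sum using (_⊎_; inj₁; inj₂)
open import Data.Empty using (⊥-elim)
open import Function using (_∘_; id)
open import Level using (0ℓ)
open import Relation.Nullary using (¬_; Dec; yes; no; ¬?)
open import Relation.Unary using (Decidable)
open import Relation.Binary.Bundles using (Setoid)
open import Relation.Binary.PropositionalEquality using (_≡_; _≢_; refl; sym; trans; cong; cong₂; subst; module ≡-Reasoning)
import Relation.Binary.Reasoning.Setoid as SetoidReasoning

-- Writing u = y/(x + a), the nonsingular points of y² = x(x + a)² are (u², u(u² + a)) with u² ≉ -a. Since p ≡ 1 (mod 4),
-- -1 is a square, hence so is -a = c², and t ↦ u = c(t + 1)/(t - 1), 1 ↦ ∞, is an isomorphism φ from 𝔽ₚ* onto E(𝔽ₚ)
-- turning the chord-and-tangent law into multiplication. Now 2ⁱm·φ(t) has order 4 iff t^(2^(i+2)m) = 1 ≠ t^(2^(i+1)m);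
-- as the squares t^(2ʲm) reach 1 at j = e (Fermat), such an i < e - 1 exists iff t^(2m) ≠ 1. By Lagrange's bound on the
-- roots of X^(2m) - 1 and of its cofactor in X^(p-1) - 1, exactly 2m units satisfy t^(2m) = 1, so the event has
-- (p - 1) - 2m = (1 - 2^(1-e))(p - 1) outcomes.

module Counting {A : Set} where

  length-++-∷ : ∀ (ys : List A) x zs → length (ys ++ x ∷ zs) ≡ suc (length (ys ++ zs))
  length-++-∷ ys x zs = begin
    length (ys ++ x ∷ zs)         ≡⟨ length-++ ys ⟩
    length ys + suc (length zs)   ≡⟨ ℕ.+-suc (length ys) (length zs) ⟩
    suc (length ys + length zs)   ≡⟨ cong suc (sym (length-++ ys)) ⟩
    suc (length (ys ++ zs))       ∎
    where open ≡-Reasoning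

  private
    ⊆-remove : ∀ {x : A} {xs ys zs} → All (x ≢_) xs → xs ⊆ ys ++ x ∷ zs → xs ⊆ ys ++ zs
    ⊆-remove {ys = ys} x∉xs xs⊆ z∈xs with ∈-++⁻ ys (xs⊆ z∈xs)
    ... | inj₁ z∈ys         = ∈-++⁺ˡ z∈ys
    ... | inj₂ (here refl)  = ⊥-elim (All.lookup x∉xs z∈xs refl)
    ... | inj₂ (there z∈zs) = ∈-++⁺ʳ ys z∈zs

  Unique∧⊆⇒length≤ : ∀ {xs ys : List A} → Unique xs → xs ⊆ ys → length xs ≤ length ys
  Unique∧⊆⇒length≤ {[]}     _                 _   = z≤n
  Unique∧⊆⇒length≤ {x ∷ xs} (x∉xs ∷ uniq) xs⊆ with ∈-∃++ (xs⊆ (here refl))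
  ... | ys , zs , refl = subst (suc (length xs) ≤_) (sym (length-++-∷ ys x zs))
          (s≤s (Unique∧⊆⇒length≤ uniq (⊆-remove x∉xs (xs⊆ ∘ there))))

  Unique∧⊆∧length≥⇒↭ : ∀ {xs ys : List A} → Unique xs → xs ⊆ ys → length ys ≤ length xs → xs ↭ ys
  Unique∧⊆∧length≥⇒↭ {[]}     {[]}    _ _ _  = ↭-refl
  Unique∧⊆∧length≥⇒↭ {x ∷ xs} (x∉xs ∷ uniq) xs⊆ len≤ with ∈-∃++ (xs⊆ (here refl))
  ... | ys , zs , refl = ↭-trans (prep x xs↭) (↭-sym (shift x ys zs))
    where
    xs↭ : xs ↭ ys ++ zs
    xs↭ = Unique∧⊆∧length≥⇒↭ uniq (⊆-remove x∉xs (xs⊆ ∘ there))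
            (ℕ.≤-pred (ℕ.≤-trans (ℕ.≤-reflexive (sym (length-++-∷ ys x zs))) len≤))

  Unique-map-on : ∀ {B : Set} (f : A → B) {xs} →
                  (∀ {x y} → x ∈ xs → y ∈ xs → f x ≡ f y → x ≡ y) → Unique xs → Unique (map f xs)
  Unique-map-on f {[]}     _   _              = []
  Unique-map-on f {x ∷ xs} inj (x∉xs ∷ uniq) =
    All.map⁺ (All.tabulate λ y∈ fx≡fy → All.lookup x∉xs y∈ (inj (here refl) (there y∈) fx≡fy))
    ∷ Unique-map-on f (λ x∈ y∈ → inj (there x∈) (there y∈)) uniq

  module _ {P : A → Set} (P? : Decidable P) where

    length-filter+length-filter-¬ : ∀ xs → length (filter P? xs) + length (filter (¬? ∘ P?) xs) ≡ length xs
    length-filter+length-filter-¬ []       = refl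
    length-filter+length-filter-¬ (x ∷ xs) with P? x
    ... | yes _ = cong suc (length-filter+length-filter-¬ xs)
    ... | no  _ = trans (ℕ.+-suc _ _) (cong suc (length-filter+length-filter-¬ xs))

    length-filter-map : ∀ {B : Set} (f : B → A) xs → length (filter P? (map f xs)) ≡ length (filter (P? ∘ f) xs)
    length-filter-map f []       = refl
    length-filter-map f (x ∷ xs) with P? (f x)
    ... | yes _ = cong suc (length-filter-map f xs)
    ... | no  _ = length-filter-map f xs

    length-filter-↭ : ∀ {xs ys} → xs ↭ ys → length (filter P? xs) ≡ length (filter P? ys)
    length-filter-↭ = ↭-length ∘ filter-↭ P?

    ∃-∉-filter : ∀ xs → length (filter P? xs) ≢ length xs → ∃ λ x → x ∈ xs × ¬ P x
    ∃-∉-filter xs len≢ = find (¬All⇒Any¬ P? xs (len≢ ∘ cong length ∘ filter-all P?))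

  module _ {P Q : A → Set} (P? : Decidable P) (Q? : Decidable Q) where

    length-filter-cong : ∀ xs → (∀ {x} → x ∈ xs → P x → Q x) → (∀ {x} → x ∈ xs → Q x → P x) →
                         length (filter P? xs) ≡ length (filter Q? xs)
    length-filter-cong []       _   _   = refl
    length-filter-cong (x ∷ xs) P⇒Q Q⇒P with P? x | Q? x
    ... | yes _  | yes _  = cong suc (length-filter-cong xs (P⇒Q ∘ there) (Q⇒P ∘ there))
    ... | no  _  | no  _  = length-filter-cong xs (P⇒Q ∘ there) (Q⇒P ∘ there)
    ... | yes px | no ¬qx = ⊥-elim (¬qx (P⇒Q (here refl) px))
    ... | no ¬px | yes qx = ⊥-elim (¬px (Q⇒P (here refl) qx))

open Counting

-- The field operations of Defs are defined inside Curve p a, although they do not involve a;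
-- the whole development therefore takes place in that context.
module Development (p : ℕ) .{{_ : NonZero p}} (a : ℕ) where

  open Curve p a public

  infix 4 _≈_ _≡ₚ_

  _≈_ : ℕ → ℕ → Set
  x ≈ y = x % p ≡ y % p

  ≈-refl : ∀ {x} → x ≈ x
  ≈-refl = refl

  ≈-setoid : Setoid 0ℓ 0ℓ
  ≈-setoid = record
    { Carrier       = ℕ
    ; _≈_           = _≈_
    ; isEquivalence = record { refl = refl ; sym = sym ; trans = trans }
    }

  module ≈-Reasoning = SetoidReasoning ≈-setoid

  ≈⇒≡ : ∀ {x y} → x < p → y < p → x ≈ y → x ≡ y
  ≈⇒≡ x<p y<p x≈y = trans (sym (m<n⇒m%n≡m x<p)) (trans x≈y (m<n⇒m%n≡m y<p))

  0%p≡0 : 0 % p ≡ 0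
  0%p≡0 = m*n%n≡0 0 p

  %-≈ : ∀ x → x % p ≈ x
  %-≈ x = m%n%n≡m%n x p

  ⊕<p : ∀ x y → x ⊕ y < p
  ⊕<p x y = m%n<n (x + y) p

  ⊗<p : ∀ x y → x ⊗ y < p
  ⊗<p x y = m%n<n (x * y) p

  neg<p : ∀ x → neg x < p
  neg<p x = m%n<n (p ∸ x % p) p

  -- Residues are compared through their images in ℤ, where ring identities can be normalised.

  ι : ℕ → ℤ
  ι = +_

  -- A record rather than a function, so that i and j can be inferred from i ≡ₚ j.
  record _≡ₚ_ (i j : ℤ) : Set where
    constructor mod-p
    field p∣i-j : + p ∣ i ℤ.- j

  private
    ∣-by : ∀ {i k l} → i ≡ k ℤ.- l → + p ∣ i → k ≡ₚ l
    ∣-by eq p∣i = mod-p (subst (+ p ∣_) eq p∣i)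

  ≡ₚ-refl : ∀ {i} → i ≡ₚ i
  ≡ₚ-refl {i} = mod-p (divides 0ℤ (trans (ℤ.+-inverseʳ i) (sym (ℤ.*-zeroˡ (+ p)))))

  ≡ₚ-reflexive : ∀ {i j} → i ≡ j → i ≡ₚ j
  ≡ₚ-reflexive refl = ≡ₚ-refl

  ≡ₚ-sym : ∀ {i j} → i ≡ₚ j → j ≡ₚ i
  ≡ₚ-sym {i} {j} (mod-p p∣i-j) = ∣-by (lemma i j) (∣m⇒∣-m p∣i-j)
    where
    lemma : ∀ i j → ℤ.- (i ℤ.- j) ≡ j ℤ.- i
    lemma = ℤ-solve-∀

  ≡ₚ-trans : ∀ {i j k} → i ≡ₚ j → j ≡ₚ k → i ≡ₚ k
  ≡ₚ-trans {i} {j} {k} (mod-p i≡j) (mod-p j≡k) = ∣-by (lemma i j k) (∣m∣n⇒∣m+n i≡j j≡k)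
    where
    lemma : ∀ i j k → (i ℤ.- j) ℤ.+ (j ℤ.- k) ≡ i ℤ.- k
    lemma = ℤ-solve-∀

  +-cong-≡ₚ : ∀ {i j k l} → i ≡ₚ j → k ≡ₚ l → i ℤ.+ k ≡ₚ j ℤ.+ l
  +-cong-≡ₚ {i} {j} {k} {l} (mod-p i≡j) (mod-p k≡l) = ∣-by (lemma i j k l) (∣m∣n⇒∣m+n i≡j k≡l)
    where
    lemma : ∀ i j k l → (i ℤ.- j) ℤ.+ (k ℤ.- l) ≡ (i ℤ.+ k) ℤ.- (j ℤ.+ l)
    lemma = ℤ-solve-∀

  *-cong-≡ₚ : ∀ {i j k l} → i ≡ₚ j → k ≡ₚ l → i ℤ.* k ≡ₚ j ℤ.* l
  *-cong-≡ₚ {i} {j} {k} {l} (mod-p i≡j) (mod-p k≡l) = ∣-by (lemma i j k l) (∣m∣n⇒∣m+n (∣m⇒∣m*n k i≡j) (∣n⇒∣m*n j k≡l))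
    where
    lemma : ∀ i j k l → (i ℤ.- j) ℤ.* k ℤ.+ j ℤ.* (k ℤ.- l) ≡ i ℤ.* k ℤ.- j ℤ.* l
    lemma = ℤ-solve-∀

  neg-cong-≡ₚ : ∀ {i j} → i ≡ₚ j → ℤ.- i ≡ₚ ℤ.- j
  neg-cong-≡ₚ {i} {j} (mod-p p∣i-j) = ∣-by (lemma i j) (∣m⇒∣-m p∣i-j)
    where
    lemma : ∀ i j → ℤ.- (i ℤ.- j) ≡ ℤ.- i ℤ.- ℤ.- j
    lemma = ℤ-solve-∀

  ι-% : ∀ x → ι (x % p) ≡ₚ ι x
  ι-% x = mod-p (divides (ℤ.- q) (begin
    ι (x % p) ℤ.- ι x                          ≡⟨ cong (λ i → ι (x % p) ℤ.- i) ι-x ⟩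
    ι (x % p) ℤ.- (ι (x % p) ℤ.+ q ℤ.* + p)    ≡⟨ lemma (ι (x % p)) q (+ p) ⟩
    ℤ.- q ℤ.* + p                              ∎))
    where
    open ≡-Reasoning
    q = + (x / p)
    ι-x : ι x ≡ ι (x % p) ℤ.+ q ℤ.* + p
    ι-x = begin
      ι x                                ≡⟨ cong ι (m≡m%n+[m/n]*n x p) ⟩
      ι (x % p + x / p * p)              ≡⟨ ℤ.pos-+ (x % p) (x / p * p) ⟩
      ι (x % p) ℤ.+ ι (x / p * p)        ≡⟨ cong (λ i → ι (x % p) ℤ.+ i) (ℤ.pos-* (x / p) p) ⟩
      ι (x % p) ℤ.+ q ℤ.* + p            ∎
    lemma : ∀ r q n → r ℤ.- (r ℤ.+ q ℤ.* n) ≡ ℤ.- q ℤ.* n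
    lemma = ℤ-solve-∀

  ≈⇒≡ₚ : ∀ {x y} → x ≈ y → ι x ≡ₚ ι y
  ≈⇒≡ₚ {x} {y} x≈y = ≡ₚ-trans (≡ₚ-sym (ι-% x)) (≡ₚ-trans (≡ₚ-reflexive (cong ι x≈y)) (ι-% y))

  private
    n≡m+kp : ∀ {m n q} → m ≤ n → ι n ℤ.- ι m ≡ q ℤ.* + p → n ≡ m + ℤ.∣ q ∣ * p
    n≡m+kp {m} {n} {q} m≤n eq = trans (sym (ℕ.m+[n∸m]≡n m≤n)) (cong (λ k → m + k) (begin
      n ∸ m                    ≡⟨ cong ℤ.∣_∣ (sym (ℤ.⊖-≥ m≤n)) ⟩
      ℤ.∣ n ℤ.⊖ m ∣             ≡⟨ cong ℤ.∣_∣ (sym (ℤ.m-n≡m⊖n n m)) ⟩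
      ℤ.∣ ι n ℤ.- ι m ∣        ≡⟨ cong ℤ.∣_∣ eq ⟩
      ℤ.∣ q ℤ.* + p ∣          ≡⟨ ℤ.abs-* q (+ p) ⟩
      ℤ.∣ q ∣ * p              ∎))
      where open ≡-Reasoning

    swap-difference : ∀ i j q → i ℤ.- j ≡ q ℤ.* + p → j ℤ.- i ≡ ℤ.- q ℤ.* + p
    swap-difference i j q eq = trans (lemma i j) (trans (cong ℤ.-_ eq) (ℤ.neg-distribˡ-* q (+ p)))
      where
      lemma : ∀ i j → j ℤ.- i ≡ ℤ.- (i ℤ.- j)
      lemma = ℤ-solve-∀

  ≡ₚ⇒≈ : ∀ {x y} → ι x ≡ₚ ι y → x ≈ y
  ≡ₚ⇒≈ {x} {y} (mod-p (divides q eq)) with ℕ.≤-total x y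
  ... | inj₁ x≤y = sym (trans (cong (_% p) (n≡m+kp {q = ℤ.- q} x≤y (swap-difference (ι x) (ι y) q eq)))
                              ([m+kn]%n≡m%n x ℤ.∣ ℤ.- q ∣ p))
  ... | inj₂ y≤x = trans (cong (_% p) (n≡m+kp {q = q} y≤x eq)) ([m+kn]%n≡m%n y ℤ.∣ q ∣ p)

  ι-⊕ : ∀ x y → ι (x ⊕ y) ≡ₚ ι x ℤ.+ ι y
  ι-⊕ x y = ≡ₚ-trans (ι-% (x + y)) (≡ₚ-reflexive (ℤ.pos-+ x y))

  ι-⊗ : ∀ x y → ι (x ⊗ y) ≡ₚ ι x ℤ.* ι y
  ι-⊗ x y = ≡ₚ-trans (ι-% (x * y)) (≡ₚ-reflexive (ℤ.pos-* x y))

  ι-neg : ∀ x → ι (neg x) ≡ₚ ℤ.- ι x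
  ι-neg x = ≡ₚ-trans (ι-% (p ∸ x % p)) (≡ₚ-trans (≡ₚ-reflexive p∸r) (≡ₚ-trans p-r≡-r (neg-cong-≡ₚ (ι-% x))))
    where
    p∸r : ι (p ∸ x % p) ≡ + p ℤ.- ι (x % p)
    p∸r = sym (trans (ℤ.m-n≡m⊖n p (x % p)) (ℤ.⊖-≥ (ℕ.<⇒≤ (m%n<n x p))))
    p-r≡-r : + p ℤ.- ι (x % p) ≡ₚ ℤ.- ι (x % p)
    p-r≡-r = mod-p (divides 1ℤ (lemma (+ p) (ι (x % p))))
      where
      lemma : ∀ n r → n ℤ.- r ℤ.- ℤ.- r ≡ 1ℤ ℤ.* n
      lemma = ℤ-solve-∀

  ⊕-cong : ∀ {x x' y y'} → x ≈ x' → y ≈ y' → x ⊕ y ≈ x' ⊕ y'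
  ⊕-cong {x} {x'} {y} {y'} x≈x' y≈y' =
    ≡ₚ⇒≈ (≡ₚ-trans (ι-⊕ x y) (≡ₚ-trans (+-cong-≡ₚ (≈⇒≡ₚ x≈x') (≈⇒≡ₚ y≈y')) (≡ₚ-sym (ι-⊕ x' y'))))

  ⊗-cong : ∀ {x x' y y'} → x ≈ x' → y ≈ y' → x ⊗ y ≈ x' ⊗ y'
  ⊗-cong {x} {x'} {y} {y'} x≈x' y≈y' =
    ≡ₚ⇒≈ (≡ₚ-trans (ι-⊗ x y) (≡ₚ-trans (*-cong-≡ₚ (≈⇒≡ₚ x≈x') (≈⇒≡ₚ y≈y')) (≡ₚ-sym (ι-⊗ x' y'))))

  neg-cong : ∀ {x x'} → x ≈ x' → neg x ≈ neg x'
  neg-cong {x} {x'} x≈x' = ≡ₚ⇒≈ (≡ₚ-trans (ι-neg x) (≡ₚ-trans (neg-cong-≡ₚ (≈⇒≡ₚ x≈x')) (≡ₚ-sym (ι-neg x'))))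

  ⊖-cong : ∀ {x x' y y'} → x ≈ x' → y ≈ y' → x ⊖ y ≈ x' ⊖ y'
  ⊖-cong x≈x' y≈y' = ⊕-cong x≈x' (neg-cong y≈y')

  infixr 8 _^ₚ_

  _^ₚ_ : ℕ → ℕ → ℕ
  x ^ₚ zero  = 1
  x ^ₚ suc n = x ⊗ (x ^ₚ n)

  :0 :1 :2 :3 : ∀ {n} → Polynomial n
  :0 = con (+ 0)
  :1 = con (+ 1)
  :2 = con (+ 2)
  :3 = con (+ 3)

  ⟦_⟧ₚ : ∀ {n} → Polynomial n → Vec ℕ n → ℕ
  ⟦ op [+] e₁ e₂ ⟧ₚ ρ = ⟦ e₁ ⟧ₚ ρ ⊕ ⟦ e₂ ⟧ₚ ρ
  ⟦ op [*] e₁ e₂ ⟧ₚ ρ = ⟦ e₁ ⟧ₚ ρ ⊗ ⟦ e₂ ⟧ₚ ρ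
  ⟦ con (+ n) ⟧ₚ    ρ = n
  ⟦ con -[1+ n ] ⟧ₚ ρ = neg (suc n)
  ⟦ var i ⟧ₚ        ρ = lookup ρ i
  ⟦ e :^ k ⟧ₚ       ρ = ⟦ e ⟧ₚ ρ ^ₚ k
  ⟦ :- e ⟧ₚ         ρ = neg (⟦ e ⟧ₚ ρ)

  ι-⟦⟧ₚ : ∀ {n} (e : Polynomial n) ρ → ι (⟦ e ⟧ₚ ρ) ≡ₚ ⟦ e ⟧ (Vec.map ι ρ)
  ι-⟦⟧ₚ (op [+] e₁ e₂) ρ = ≡ₚ-trans (ι-⊕ (⟦ e₁ ⟧ₚ ρ) (⟦ e₂ ⟧ₚ ρ)) (+-cong-≡ₚ (ι-⟦⟧ₚ e₁ ρ) (ι-⟦⟧ₚ e₂ ρ))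
  ι-⟦⟧ₚ (op [*] e₁ e₂) ρ = ≡ₚ-trans (ι-⊗ (⟦ e₁ ⟧ₚ ρ) (⟦ e₂ ⟧ₚ ρ)) (*-cong-≡ₚ (ι-⟦⟧ₚ e₁ ρ) (ι-⟦⟧ₚ e₂ ρ))
  ι-⟦⟧ₚ (con (+ n))    ρ = ≡ₚ-refl
  ι-⟦⟧ₚ (con -[1+ n ]) ρ = ι-neg (suc n)
  ι-⟦⟧ₚ (var i)        ρ = ≡ₚ-reflexive (sym (Vec.lookup-map i ι ρ))
  ι-⟦⟧ₚ (e :^ zero)    ρ = ≡ₚ-refl
  ι-⟦⟧ₚ (e :^ suc k)   ρ = ≡ₚ-trans (ι-⊗ (⟦ e ⟧ₚ ρ) (⟦ e :^ k ⟧ₚ ρ)) (*-cong-≡ₚ (ι-⟦⟧ₚ e ρ) (ι-⟦⟧ₚ (e :^ k) ρ))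
  ι-⟦⟧ₚ (:- e)         ρ = ≡ₚ-trans (ι-neg (⟦ e ⟧ₚ ρ)) (neg-cong-≡ₚ (ι-⟦⟧ₚ e ρ))

  solve : ∀ n (f : N-ary n (Polynomial n) (Polynomial n × Polynomial n)) →
          let lhs , rhs = f $ⁿ Vec.map var (Vec.allFin n) in
          (∀ ρ → ⟦ lhs ⟧↓ ρ ≡ ⟦ rhs ⟧↓ ρ) → ∀ ρ → ⟦ lhs ⟧ₚ ρ ≈ ⟦ rhs ⟧ₚ ρ
  solve n f nf-eq ρ = ≡ₚ⇒≈ (≡ₚ-trans (ι-⟦⟧ₚ lhs ρ)
                          (≡ₚ-trans (≡ₚ-reflexive (prove (Vec.map ι ρ) lhs rhs (nf-eq _))) (≡ₚ-sym (ι-⟦⟧ₚ rhs ρ))))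
    where
    lhs = proj₁ (f $ⁿ Vec.map var (Vec.allFin n))
    rhs = proj₂ (f $ⁿ Vec.map var (Vec.allFin n))

  infix 4 _≉_

  _≉_ : ℕ → ℕ → Set
  x ≉ y = ¬ x ≈ y

  ⊖≈0⇒≈ : ∀ {x y} → x ⊖ y ≈ 0 → x ≈ y
  ⊖≈0⇒≈ {x} {y} x-y≈0 = begin
    x                ≈⟨ solve 2 (λ x y → x := (x :- y) :+ y) (λ _ → refl) (x ∷ y ∷ []) ⟩
    (x ⊖ y) ⊕ y      ≈⟨ ⊕-cong x-y≈0 (≈-refl {y}) ⟩
    0 ⊕ y            ≈⟨ solve 1 (λ y → :0 :+ y := y) (λ _ → refl) (y ∷ []) ⟩
    y                ∎
    where open ≈-Reasoning

  ≈⇒⊖≈0 : ∀ {x y} → x ≈ y → x ⊖ y ≈ 0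
  ≈⇒⊖≈0 {x} {y} x≈y = trans (⊖-cong x≈y (≈-refl {y})) (solve 1 (λ y → y :- y := :0) (λ _ → refl) (y ∷ []))

  ⊕-comm : ∀ x y → x ⊕ y ≈ y ⊕ x
  ⊕-comm x y = solve 2 (λ x y → x :+ y := y :+ x) (λ _ → refl) (x ∷ y ∷ [])

  ⊕-cancel-≈0 : ∀ {x y} → y ≈ 0 → x ⊕ y ≈ 0 → x ≈ 0
  ⊕-cancel-≈0 {x} {y} y≈0 x+y≈0 =
    trans (solve 1 (λ x → x := x :+ :0) (λ _ → refl) (x ∷ [])) (trans (⊕-cong (≈-refl {x}) (sym y≈0)) x+y≈0)

  ⊗-≈0ˡ : ∀ {x} y → x ≈ 0 → x ⊗ y ≈ 0
  ⊗-≈0ˡ {x} y x≈0 = trans (⊗-cong x≈0 (≈-refl {y})) (solve 1 (λ y → :0 :* y := :0) (λ _ → refl) (y ∷ []))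

  ⊗-≈0ʳ : ∀ x {y} → y ≈ 0 → x ⊗ y ≈ 0
  ⊗-≈0ʳ x {y} y≈0 = trans (⊗-cong (≈-refl {x}) y≈0) (solve 1 (λ x → x :* :0 := :0) (λ _ → refl) (x ∷ []))

  ^ₚ-cong : ∀ {x y} n → x ≈ y → x ^ₚ n ≈ y ^ₚ n
  ^ₚ-cong zero    x≈y = refl
  ^ₚ-cong (suc n) x≈y = ⊗-cong x≈y (^ₚ-cong n x≈y)

  ^ₚ-+ : ∀ x m n → x ^ₚ (m + n) ≈ (x ^ₚ m) ⊗ (x ^ₚ n)
  ^ₚ-+ x zero    n = sym (solve 1 (λ y → :1 :* y := y) (λ _ → refl) (x ^ₚ n ∷ []))
  ^ₚ-+ x (suc m) n = trans (⊗-cong (≈-refl {x}) (^ₚ-+ x m n))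
    (solve 3 (λ x a b → x :* (a :* b) := (x :* a) :* b) (λ _ → refl) (x ∷ x ^ₚ m ∷ x ^ₚ n ∷ []))

  ^ₚ-distrib-⊗ : ∀ x y n → (x ⊗ y) ^ₚ n ≈ (x ^ₚ n) ⊗ (y ^ₚ n)
  ^ₚ-distrib-⊗ x y zero    = solve 0 (:1 := :1 :* :1) (λ _ → refl) []
  ^ₚ-distrib-⊗ x y (suc n) = trans (⊗-cong (≈-refl {x ⊗ y}) (^ₚ-distrib-⊗ x y n))
    (solve 4 (λ x y a b → (x :* y) :* (a :* b) := (x :* a) :* (y :* b)) (λ _ → refl) (x ∷ y ∷ x ^ₚ n ∷ y ^ₚ n ∷ []))

  1^ₚ : ∀ n → 1 ^ₚ n ≈ 1
  1^ₚ zero    = refl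
  1^ₚ (suc n) = trans (⊗-cong (≈-refl {1}) (1^ₚ n)) (solve 0 (:1 :* :1 := :1) (λ _ → refl) [])

  ^ₚ-* : ∀ x m n → x ^ₚ (m * n) ≈ (x ^ₚ m) ^ₚ n
  ^ₚ-* x zero    n = sym (1^ₚ n)
  ^ₚ-* x (suc m) n = trans (^ₚ-+ x n (m * n))
    (trans (⊗-cong (≈-refl {x ^ₚ n}) (^ₚ-* x m n)) (sym (^ₚ-distrib-⊗ x (x ^ₚ m) n)))

  ^ₚ≈^ : ∀ x n → x ^ₚ n ≈ x ^ n
  ^ₚ≈^ x zero    = refl
  ^ₚ≈^ x (suc n) = trans (⊗-cong (≈-refl {x}) (^ₚ≈^ x n)) (%-≈ (x * x ^ n))

  module PrimeField (p-prime : Prime p) where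

    1<p : 1 < p
    1<p = nonTrivial⇒n>1 p {{prime⇒nonTrivial p-prime}}

    0<p : 0 < p
    0<p = ℕ.<-trans z<s 1<p

    1≉0 : 1 ≉ 0
    1≉0 1≈0 = ℕ.1+n≢0 (≈⇒≡ 1<p 0<p 1≈0)

    ^ₚ<p : ∀ x n → x ^ₚ n < p
    ^ₚ<p x zero    = 1<p
    ^ₚ<p x (suc n) = ⊗<p x (x ^ₚ n)

    ≢0⇒≉0 : ∀ {x} → x < p → x ≢ 0 → x ≉ 0
    ≢0⇒≉0 x<p x≢0 x≈0 = x≢0 (≈⇒≡ x<p 0<p x≈0)

    ≈0⇒p∣ : ∀ {x} → x ≈ 0 → p ∣ℕ x
    ≈0⇒p∣ {x} x≈0 = m%n≡0⇒n∣m x p (trans x≈0 0%p≡0)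

    ⊗≈0⇒ : ∀ {x y} → x ⊗ y ≈ 0 → x ≈ 0 ⊎ y ≈ 0
    ⊗≈0⇒ {x} {y} xy≈0 = Sum.map p∣⇒≈0 p∣⇒≈0 (euclidsLemma x y p-prime (≈0⇒p∣ (trans (sym (%-≈ (x * y))) xy≈0)))
      where
      p∣⇒≈0 : ∀ {z} → p ∣ℕ z → z ≈ 0
      p∣⇒≈0 {z} p∣z = trans (n∣m⇒m%n≡0 z p p∣z) (sym 0%p≡0)

    ⊗-≉0 : ∀ {x y} → x ≉ 0 → y ≉ 0 → x ⊗ y ≉ 0
    ⊗-≉0 x≉0 y≉0 = Sum.[ x≉0 , y≉0 ]′ ∘ ⊗≈0⇒

    ^ₚ-≉0 : ∀ {x} n → x ≉ 0 → x ^ₚ n ≉ 0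
    ^ₚ-≉0 zero    _   = 1≉0
    ^ₚ-≉0 (suc n) x≉0 = ⊗-≉0 x≉0 (^ₚ-≉0 n x≉0)

    ⊗-cancelʳ : ∀ {x y d} → d ≉ 0 → x ⊗ d ≈ y ⊗ d → x ≈ y
    ⊗-cancelʳ {x} {y} {d} d≉0 xd≈yd =
      Sum.[ ⊖≈0⇒≈ , ⊥-elim ∘ d≉0 ]′ (⊗≈0⇒ (trans
        (solve 3 (λ x y d → (x :- y) :* d := (x :* d) :- (y :* d)) (λ _ → refl) (x ∷ y ∷ d ∷ []))
        (≈⇒⊖≈0 xd≈yd)))

    ⊗-cancelˡ : ∀ {x y d} → d ≉ 0 → d ⊗ x ≈ d ⊗ y → x ≈ y
    ⊗-cancelˡ {x} {y} {d} d≉0 dx≈dy = ⊗-cancelʳ d≉0 (begin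
      x ⊗ d  ≈⟨ solve 2 (λ x d → x :* d := d :* x) (λ _ → refl) (x ∷ d ∷ []) ⟩
      d ⊗ x  ≈⟨ dx≈dy ⟩
      d ⊗ y  ≈⟨ solve 2 (λ y d → d :* y := y :* d) (λ _ → refl) (y ∷ d ∷ []) ⟩
      y ⊗ d  ∎)
      where open ≈-Reasoning

    units : List ℕ
    units = map suc (upTo (p ∸ 1))

    private
      suc[p∸1]≡p : suc (p ∸ 1) ≡ p
      suc[p∸1]≡p = ℕ.suc-pred p

    ∈units⁻ : ∀ {t} → t ∈ units → t ≢ 0 × t < p
    ∈units⁻ t∈ with ∈-map⁻ suc t∈
    ... | k , k∈ , refl = (λ ()) , subst (suc k <_) suc[p∸1]≡p (s≤s (∈-upTo⁻ k∈))

    ∈units⁺ : ∀ {t} → t ≢ 0 → t < p → t ∈ units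
    ∈units⁺ {zero}  t≢0 _   = ⊥-elim (t≢0 refl)
    ∈units⁺ {suc k} _   t<p = ∈-map⁺ suc (∈-upTo⁺ (ℕ.≤-pred (subst (suc k <_) (sym suc[p∸1]≡p) t<p)))

    units-<p : ∀ {t} → t ∈ units → t < p
    units-<p = proj₂ ∘ ∈units⁻

    units-≉0 : ∀ {t} → t ∈ units → t ≉ 0
    units-≉0 t∈ = ≢0⇒≉0 (units-<p t∈) (proj₁ (∈units⁻ t∈))

    ≉0⇒∈units : ∀ {t} → t < p → t ≉ 0 → t ∈ units
    ≉0⇒∈units {t} t<p t≉0 = ∈units⁺ (λ t≡0 → t≉0 (cong (_% p) t≡0)) t<p

    1∈units : 1 ∈ units
    1∈units = ∈units⁺ (λ ()) 1<p

    ^ₚ-∈units : ∀ {t} n → t ∈ units → t ^ₚ n ∈ units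
    ^ₚ-∈units {t} n t∈ = ≉0⇒∈units (^ₚ<p t n) (^ₚ-≉0 n (units-≉0 t∈))

    Unique-units : Unique units
    Unique-units = Unique.map⁺ ℕ.suc-injective (Unique.upTo⁺ (p ∸ 1))

    length-units : length units ≡ p ∸ 1
    length-units = trans (length-map suc (upTo (p ∸ 1))) (length-upTo (p ∸ 1))

    ∏ : List ℕ → ℕ
    ∏ []       = 1
    ∏ (x ∷ xs) = x ⊗ ∏ xs

    ∏-↭ : ∀ {xs ys} → xs ↭ ys → ∏ xs ≈ ∏ ys
    ∏-↭ ↭.refl                = refl
    ∏-↭ (prep x xs↭ys)        = ⊗-cong (≈-refl {x}) (∏-↭ xs↭ys)
    ∏-↭ (↭.trans xs↭ys ys↭zs) = trans (∏-↭ xs↭ys) (∏-↭ ys↭zs)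
    ∏-↭ {_ ∷ _ ∷ _} {_ ∷ _ ∷ ys} (swap x y xs↭ys) = trans (⊗-cong (≈-refl {x}) (⊗-cong (≈-refl {y}) (∏-↭ xs↭ys)))
      (solve 3 (λ x y z → x :* (y :* z) := y :* (x :* z)) (λ _ → refl) (x ∷ y ∷ ∏ ys ∷ []))

    ∏-map-⊗ : ∀ t xs → ∏ (map (t ⊗_) xs) ≈ (t ^ₚ length xs) ⊗ ∏ xs
    ∏-map-⊗ t []       = solve 0 (:1 := :1 :* :1) (λ _ → refl) []
    ∏-map-⊗ t (x ∷ xs) = trans (⊗-cong (≈-refl {t ⊗ x}) (∏-map-⊗ t xs))
      (solve 4 (λ t x a b → (t :* x) :* (a :* b) := (t :* a) :* (x :* b)) (λ _ → refl) (t ∷ x ∷ t ^ₚ length xs ∷ ∏ xs ∷ []))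

    ∏-≉0 : ∀ xs → (∀ {x} → x ∈ xs → x ≉ 0) → ∏ xs ≉ 0
    ∏-≉0 []       _     = 1≉0
    ∏-≉0 (x ∷ xs) xs≉0 = ⊗-≉0 (xs≉0 (here refl)) (∏-≉0 xs (xs≉0 ∘ there))

    -- Multiplication by a unit t permutes the units, so t^(p-1) ∏ units ≈ ∏ units.
    fermat : ∀ {t} → t ≉ 0 → t ^ₚ (p ∸ 1) ≈ 1
    fermat {t} t≉0 = ⊗-cancelʳ (∏-≉0 units units-≉0) (begin
      (t ^ₚ (p ∸ 1)) ⊗ ∏ units         ≡⟨ cong (λ n → (t ^ₚ n) ⊗ ∏ units) (sym length-units) ⟩
      (t ^ₚ length units) ⊗ ∏ units    ≈⟨ ∏-map-⊗ t units ⟨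
      ∏ (map (t ⊗_) units)             ≈⟨ ∏-↭ t·units↭units ⟩
      ∏ units                          ≈⟨ solve 1 (λ y → y := :1 :* y) (λ _ → refl) (∏ units ∷ []) ⟩
      1 ⊗ ∏ units                      ∎)
      where
      open ≈-Reasoning
      t·units⊆units : map (t ⊗_) units ⊆ units
      t·units⊆units z∈ with ∈-map⁻ (t ⊗_) z∈
      ... | k , k∈ , refl = ≉0⇒∈units (⊗<p t k) (⊗-≉0 t≉0 (units-≉0 k∈))
      t⊗-injective : ∀ {x y} → x ∈ units → y ∈ units → t ⊗ x ≡ t ⊗ y → x ≡ y
      t⊗-injective x∈ y∈ tx≡ty = ≈⇒≡ (units-<p x∈) (units-<p y∈) (⊗-cancelˡ t≉0 (cong (_% p) tx≡ty))
      t·units↭units : map (t ⊗_) units ↭ units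
      t·units↭units = Unique∧⊆∧length≥⇒↭ (Unique-map-on (t ⊗_) t⊗-injective Unique-units) t·units⊆units
                        (ℕ.≤-reflexive (sym (length-map (t ⊗_) units)))

    ⊗-inv : ∀ {x} → x ≉ 0 → x ⊗ inv x ≈ 1
    ⊗-inv {x} x≉0 = begin
      x ⊗ inv x                ≈⟨ ⊗-cong (≈-refl {x}) inv≈x^ₚ[p∸2] ⟩
      x ^ₚ suc (p ∸ 2)         ≡⟨ cong (x ^ₚ_) (sym (ℕ.+-∸-assoc 1 1<p)) ⟩
      x ^ₚ (p ∸ 1)             ≈⟨ fermat x≉0 ⟩
      1                        ∎
      where
      open ≈-Reasoning
      inv≈x^ₚ[p∸2] : inv x ≈ x ^ₚ (p ∸ 2)
      inv≈x^ₚ[p∸2] = trans (%-≈ _) (trans (sym (^ₚ≈^ (x % p) (p ∸ 2))) (^ₚ-cong (p ∸ 2) (%-≈ x)))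

    ⊘-⊗ : ∀ {x d} → d ≉ 0 → (x ⊘ d) ⊗ d ≈ x
    ⊘-⊗ {x} {d} d≉0 = begin
      (x ⊘ d) ⊗ d        ≈⟨ solve 3 (λ x i d → (x :* i) :* d := x :* (d :* i)) (λ _ → refl) (x ∷ inv d ∷ d ∷ []) ⟩
      x ⊗ (d ⊗ inv d)    ≈⟨ ⊗-cong (≈-refl {x}) (⊗-inv d≉0) ⟩
      x ⊗ 1              ≈⟨ solve 1 (λ x → x :* :1 := x) (λ _ → refl) (x ∷ []) ⟩
      x                  ∎
      where open ≈-Reasoning

    ⊗≈⇒≈⊘ : ∀ {w x d} → d ≉ 0 → w ⊗ d ≈ x → w ≈ x ⊘ d
    ⊗≈⇒≈⊘ d≉0 wd≈x = ⊗-cancelʳ d≉0 (trans wd≈x (sym (⊘-⊗ d≉0)))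

    -- Polynomials are coefficient lists, constant term first.
    eval : List ℕ → ℕ → ℕ
    eval []       x = 0
    eval (c ∷ cs) x = c ⊕ (x ⊗ eval cs x)

    synthDiv : ℕ → List ℕ → List ℕ
    synthDiv r []       = []
    synthDiv r (_ ∷ cs) = go cs
      where
      go : List ℕ → List ℕ
      go []       = []
      go (d ∷ ds) = eval (d ∷ ds) r ∷ go ds

    length-synthDiv : ∀ r cs → length (synthDiv r cs) ≡ length cs ∸ 1
    length-synthDiv r []       = refl
    length-synthDiv r (_ ∷ cs) = go cs
      where
      go : ∀ ds → length (synthDiv r (0 ∷ ds)) ≡ length ds
      go []       = refl
      go (d ∷ ds) = cong suc (go ds)

    factor-theorem : ∀ r cs x → eval cs x ≈ ((x ⊖ r) ⊗ eval (synthDiv r cs) x) ⊕ eval cs r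
    factor-theorem r [] x =
      solve 2 (λ x r → :0 := ((x :- r) :* :0) :+ :0) (λ _ → refl) (x ∷ r ∷ [])
    factor-theorem r (c ∷ []) x =
      solve 3 (λ c x r → c :+ (x :* :0) := ((x :- r) :* :0) :+ (c :+ (r :* :0)))
        (λ _ → refl) (c ∷ x ∷ r ∷ [])
    factor-theorem r (c ∷ d ∷ ds) x = trans (⊕-cong (≈-refl {c}) (⊗-cong (≈-refl {x}) (factor-theorem r (d ∷ ds) x)))
      (solve 5 (λ c x r q e → c :+ (x :* (((x :- r) :* q) :+ e)) := ((x :- r) :* (e :+ (x :* q))) :+ (c :+ (r :* e)))
        (λ _ → refl) (c ∷ x ∷ r ∷ eval (synthDiv r (d ∷ ds)) x ∷ eval (d ∷ ds) r ∷ []))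

    eval-[] : ∀ cs → length cs ≤ 0 → eval cs 0 ≈ 0
    eval-[] [] _ = refl

    -- A nonzero constant term certifies that a polynomial is nonzero, and it passes to the quotient by X - r.
    roots≤degree : ∀ n cs → length cs ≤ suc n → eval cs 0 ≉ 0 →
                   ∀ rs → Unique rs → (∀ {r} → r ∈ rs → r < p) → (∀ {r} → r ∈ rs → eval cs r ≈ 0) → length rs ≤ n
    roots≤degree n cs len≤ cs[0]≉0 []       _             _    _     = z≤n
    roots≤degree n cs len≤ cs[0]≉0 (r ∷ rs) (r∉rs ∷ uniq) rs<p roots = bound n len≤
      where
      q = synthDiv r cs
      cs[r]≈0 : eval cs r ≈ 0
      cs[r]≈0 = roots (here refl)

      length-q≤ : ∀ {m} → length cs ≤ suc m → length q ≤ m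
      length-q≤ len≤ = ℕ.≤-trans (ℕ.≤-reflexive (length-synthDiv r cs)) (ℕ.∸-monoˡ-≤ 1 len≤)

      q[0]≉0 : eval q 0 ≉ 0
      q[0]≉0 q[0]≈0 = cs[0]≉0 (begin
        eval cs 0                                  ≈⟨ factor-theorem r cs 0 ⟩
        ((0 ⊖ r) ⊗ eval q 0) ⊕ eval cs r           ≈⟨ ⊕-cong (⊗-≈0ʳ (0 ⊖ r) q[0]≈0) cs[r]≈0 ⟩
        0 ⊕ 0                                      ≈⟨ solve 0 (:0 :+ :0 := :0) (λ _ → refl) [] ⟩
        0                                          ∎)
        where open ≈-Reasoning

      q-roots : ∀ {s} → s ∈ rs → eval q s ≈ 0
      q-roots {s} s∈ = Sum.[ ⊥-elim ∘ s≉r ∘ ⊖≈0⇒≈ , id ]′ (⊗≈0⇒ (⊕-cancel-≈0 cs[r]≈0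
        (trans (sym (factor-theorem r cs s)) (roots (there s∈)))))
        where
        s≉r : s ≉ r
        s≉r s≈r = All.lookup r∉rs s∈ (sym (≈⇒≡ (rs<p (there s∈)) (rs<p (here refl)) s≈r))

      bound : ∀ m → length cs ≤ suc m → length (r ∷ rs) ≤ m
      bound zero    len≤ = ⊥-elim (q[0]≉0 (eval-[] q (length-q≤ len≤)))
      bound (suc m) len≤ = s≤s (roots≤degree m q (length-q≤ len≤) q[0]≉0 rs uniq (rs<p ∘ there) q-roots)

    eval-X^k· : ∀ k cs x → eval (replicate k 0 ++ cs) x ≈ (x ^ₚ k) ⊗ eval cs x
    eval-X^k· zero    cs x = solve 1 (λ y → y := :1 :* y) (λ _ → refl) (eval cs x ∷ [])
    eval-X^k· (suc k) cs x = trans (⊕-cong (≈-refl {0}) (⊗-cong (≈-refl {x}) (eval-X^k· k cs x)))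
      (solve 3 (λ x a b → :0 :+ (x :* (a :* b)) := (x :* a) :* b) (λ _ → refl) (x ∷ x ^ₚ k ∷ eval cs x ∷ []))

    X^[1+_]-1 : ℕ → List ℕ
    X^[1+ k ]-1 = neg 1 ∷ replicate k 0 ++ [ 1 ]

    length-X^[1+k]-1 : ∀ k → length X^[1+ k ]-1 ≡ suc (suc k)
    length-X^[1+k]-1 k = cong suc (trans (length-++ (replicate k 0)) (trans (cong (_+ 1) (length-replicate k)) (ℕ.+-comm k 1)))

    eval-X^[1+k]-1 : ∀ k x → eval X^[1+ k ]-1 x ≈ (x ^ₚ suc k) ⊖ 1
    eval-X^[1+k]-1 k x = trans (⊕-cong (≈-refl {neg 1}) (⊗-cong (≈-refl {x}) (eval-X^k· k [ 1 ] x)))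
      (solve 2 (λ x a → (:- :1) :+ (x :* (a :* (:1 :+ (x :* :0)))) := (x :* a) :- :1)
        (λ _ → refl) (x ∷ x ^ₚ k ∷ []))

    X^[1+k]-1[0]≉0 : ∀ k → eval X^[1+ k ]-1 0 ≉ 0
    X^[1+k]-1[0]≉0 k ≈0 = 1≉0 (trans
      (solve 1 (λ y → :1 := :- ((:- :1) :+ (:0 :* y))) (λ _ → refl) (eval (replicate k 0 ++ [ 1 ]) 0 ∷ []))
      (trans (neg-cong ≈0) (solve 0 (:- :0 := :0) (λ _ → refl) [])))

    -- 1 + X^d + X^(2d) + … + X^(Kd) with d = 1 + k
    geometric : ℕ → ℕ → List ℕ
    geometric k zero    = [ 1 ]
    geometric k (suc K) = 1 ∷ replicate k 0 ++ geometric k K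

    length-geometric : ∀ k K → length (geometric k K) ≡ suc (K * suc k)
    length-geometric k zero    = refl
    length-geometric k (suc K) = cong suc (trans (length-++ (replicate k 0))
      (trans (cong₂ _+_ (length-replicate k) (length-geometric k K)) (ℕ.+-suc k (K * suc k))))

    geometric[0]≉0 : ∀ k K → eval (geometric k K) 0 ≉ 0
    geometric[0]≉0 k zero    ≈0 = 1≉0 (trans (solve 0 (:1 := :1 :+ (:0 :* :0)) (λ _ → refl) []) ≈0)
    geometric[0]≉0 k (suc K) ≈0 = 1≉0 (trans
      (solve 1 (λ y → :1 := :1 :+ (:0 :* y)) (λ _ → refl) (eval (replicate k 0 ++ geometric k K) 0 ∷ [])) ≈0)

    eval-geometric : ∀ k K x → ((x ^ₚ suc k) ⊖ 1) ⊗ eval (geometric k K) x ≈ (x ^ₚ (suc k * suc K)) ⊖ 1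
    eval-geometric k zero x =
      trans (solve 2 (λ y x → (y :- :1) :* (:1 :+ (x :* :0)) := y :- :1) (λ _ → refl) (x ^ₚ suc k ∷ x ∷ []))
            (cong (λ n → ((x ^ₚ n) ⊖ 1) % p) (sym (ℕ.*-identityʳ (suc k))))
    eval-geometric k (suc K) x = begin
      (y ⊖ 1) ⊗ eval (geometric k (suc K)) x     ≈⟨ ⊗-cong (≈-refl {y ⊖ 1}) eval-step ⟩
      (y ⊖ 1) ⊗ (1 ⊕ (y ⊗ g))                    ≈⟨ solve 2 (λ y g → (y :- :1) :* (:1 :+ (y :* g))
                                                            := (y :- :1) :+ (y :* ((y :- :1) :* g))) (λ _ → refl) (y ∷ g ∷ []) ⟩
      (y ⊖ 1) ⊕ (y ⊗ ((y ⊖ 1) ⊗ g))              ≈⟨ ⊕-cong (≈-refl {y ⊖ 1}) (⊗-cong (≈-refl {y}) (eval-geometric k K x)) ⟩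
      (y ⊖ 1) ⊕ (y ⊗ ((x ^ₚ (d * suc K)) ⊖ 1))   ≈⟨ solve 2 (λ y z → (y :- :1) :+ (y :* (z :- :1)) := (y :* z) :- :1)
                                                            (λ _ → refl) (y ∷ x ^ₚ (d * suc K) ∷ []) ⟩
      (y ⊗ (x ^ₚ (d * suc K))) ⊖ 1               ≈⟨ ⊖-cong (^ₚ-+ x d (d * suc K)) (≈-refl {1}) ⟨
      (x ^ₚ (d + d * suc K)) ⊖ 1                 ≡⟨ cong (λ n → (x ^ₚ n) ⊖ 1) (sym (ℕ.*-suc d (suc K))) ⟩
      (x ^ₚ (d * suc (suc K))) ⊖ 1               ∎
      where
      open ≈-Reasoning
      d = suc k
      y = x ^ₚ d
      g = eval (geometric k K) x
      eval-step : eval (geometric k (suc K)) x ≈ 1 ⊕ (y ⊗ g)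
      eval-step = trans (⊕-cong (≈-refl {1}) (⊗-cong (≈-refl {x}) (eval-X^k· k (geometric k K) x)))
        (solve 3 (λ x a g → :1 :+ (x :* (a :* g)) := :1 :+ ((x :* a) :* g)) (λ _ → refl) (x ∷ x ^ₚ k ∷ g ∷ []))

    _IsRootOfUnity_ : ℕ → ℕ → Set
    d IsRootOfUnity t = t ^ₚ d ≡ 1

    _IsRootOfUnity?_ : ∀ d → Decidable (d IsRootOfUnity_)
    d IsRootOfUnity? t = t ^ₚ d ≟ 1

    -- The units that are not d-th roots of unity are roots of 1 + X^d + … + X^(d(K-1)), as t^(dK) ≈ 1 by Fermat;
    -- the two root bounds add up to p - 1 = dK.
    #rootsOfUnity : ∀ d K → 0 < d → 0 < K → d * K ≡ p ∸ 1 → length (filter (d IsRootOfUnity?_) units) ≡ d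
    #rootsOfUnity (suc k) (suc K) _ _ dK≡p-1 = ℕ.≤-antisym #roots≤d (ℕ.≮⇒≥ #roots≮d)
      where
      d = suc k
      roots    = filter (d IsRootOfUnity?_) units
      nonroots = filter (¬? ∘ (d IsRootOfUnity?_)) units

      ∈filter⇒∈units : ∀ {t} {P : ℕ → Set} (P? : Decidable P) → t ∈ filter P? units → t ∈ units
      ∈filter⇒∈units P? t∈ = proj₁ (∈-filter⁻ P? t∈)

      #roots≤d : length roots ≤ d
      #roots≤d = roots≤degree d X^[1+ k ]-1 (ℕ.≤-reflexive (length-X^[1+k]-1 k)) (X^[1+k]-1[0]≉0 k) roots
        (Unique.filter⁺ _ Unique-units) (units-<p ∘ ∈filter⇒∈units _)
        (λ {t} t∈ → trans (eval-X^[1+k]-1 k t) (≈⇒⊖≈0 (cong (_% p) (proj₂ (∈-filter⁻ _ {xs = units} t∈)))))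

      #nonroots≤dK : length nonroots ≤ K * d
      #nonroots≤dK = roots≤degree (K * d) (geometric k K) (ℕ.≤-reflexive (length-geometric k K)) (geometric[0]≉0 k K)
        nonroots (Unique.filter⁺ _ Unique-units) (units-<p ∘ ∈filter⇒∈units _) geometric-root
        where
        geometric-root : ∀ {t} → t ∈ nonroots → eval (geometric k K) t ≈ 0
        geometric-root {t} t∈ with ∈-filter⁻ _ {xs = units} t∈
        ... | t∈units , tᵈ≢1 = Sum.[ ⊥-elim ∘ tᵈ≢1 ∘ ≈⇒≡ (^ₚ<p t d) 1<p ∘ ⊖≈0⇒≈ , id ]′
          (⊗≈0⇒ (trans (eval-geometric k K t)
            (≈⇒⊖≈0 (trans (cong (λ n → (t ^ₚ n) % p) dK≡p-1) (fermat (units-≉0 t∈units))))))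

      #roots≮d : ¬ (length roots < d)
      #roots≮d #roots<d = ℕ.<-irrefl (begin
        length roots + length nonroots   ≡⟨ length-filter+length-filter-¬ (d IsRootOfUnity?_) units ⟩
        length units                     ≡⟨ length-units ⟩
        p ∸ 1                            ≡⟨ sym dK≡p-1 ⟩
        d * suc K                        ≡⟨ ℕ.*-suc d K ⟩
        d + d * K                        ≡⟨ cong (λ n → d + n) (ℕ.*-comm d K) ⟩
        d + K * d                        ∎) (ℕ.+-mono-<-≤ #roots<d #nonroots≤dK)
        where open ≡-Reasoning

    ≉1⇒≈-1 : ∀ {x} → x < p → x ⊗ x ≈ 1 → x ≢ 1 → x ≈ neg 1
    ≉1⇒≈-1 {x} x<p x²≈1 x≢1 = Sum.[ ⊥-elim ∘ x≢1 ∘ ≈⇒≡ x<p 1<p ∘ ⊖≈0⇒≈ , x+1≈0⇒x≈-1 ]′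
      (⊗≈0⇒ (trans (solve 1 (λ x → (x :- :1) :* (x :+ :1) := (x :* x) :- :1) (λ _ → refl) (x ∷ []))
                   (≈⇒⊖≈0 x²≈1)))
      where
      x+1≈0⇒x≈-1 : x ⊕ 1 ≈ 0 → x ≈ neg 1
      x+1≈0⇒x≈-1 x+1≈0 = trans (solve 1 (λ x → x := (x :+ :1) :- :1) (λ _ → refl) (x ∷ []))
        (trans (⊖-cong x+1≈0 (≈-refl {1})) (solve 0 (:0 :- :1 := :- :1) (λ _ → refl) []))

    -- A unit g with g^(2Q) ≢ 1 exists because only 2Q < p - 1 units are 2Q-th roots of unity; then (g^Q)² ≈ -1.
    ∃√-1 : ∀ Q → 0 < Q → 4 * Q ≡ p ∸ 1 → ∃ λ i → i ⊗ i ≈ neg 1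
    ∃√-1 Q Q>0 4Q≡p-1 = g ^ₚ Q , trans (sym (^ₚ-+ g Q Q)) (≉1⇒≈-1 (^ₚ<p g (Q + Q)) g^[2Q]² g^[2Q]≢1)
      where
      h = Q + Q
      h+h≡p-1 : h + h ≡ p ∸ 1
      h+h≡p-1 = trans (lemma Q) 4Q≡p-1
        where
        lemma : ∀ Q → (Q + Q) + (Q + Q) ≡ 4 * Q
        lemma = ℕ-solve-∀

      h*2≡p-1 : h * 2 ≡ p ∸ 1
      h*2≡p-1 = trans (lemma Q) 4Q≡p-1
        where
        lemma : ∀ Q → (Q + Q) * 2 ≡ 4 * Q
        lemma = ℕ-solve-∀

      h>0 : 0 < h
      h>0 = ℕ.<-≤-trans Q>0 (ℕ.m≤m+n Q Q)

      #roots≢#units : length (filter (h IsRootOfUnity?_) units) ≢ length units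
      #roots≢#units #roots≡#units = ℕ.<-irrefl
        (trans (sym (#rootsOfUnity h 2 h>0 z<s h*2≡p-1))
          (trans #roots≡#units (trans length-units (sym h+h≡p-1))))
        (ℕ.m<m+n h h>0)

      non-root : ∃ λ g → g ∈ units × ¬ h IsRootOfUnity g
      non-root = ∃-∉-filter (h IsRootOfUnity?_) units #roots≢#units
      g = proj₁ non-root
      g^[2Q]≢1 : g ^ₚ h ≢ 1
      g^[2Q]≢1 = proj₂ (proj₂ non-root)

      g^[2Q]² : (g ^ₚ h) ⊗ (g ^ₚ h) ≈ 1
      g^[2Q]² = trans (sym (^ₚ-+ g h h)) (trans (cong (λ n → (g ^ₚ n) % p) h+h≡p-1) (fermat (units-≉0 (proj₁ (proj₂ non-root)))))

    ∃√[-b²] : ∀ b Q → 0 < Q → 4 * Q ≡ p ∸ 1 → ∃ λ c → c ⊗ c ≈ neg (b ⊗ b)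
    ∃√[-b²] b Q Q>0 4Q≡p-1 = b ⊗ i , (begin
      (b ⊗ i) ⊗ (b ⊗ i)       ≈⟨ solve 2 (λ b i → (b :* i) :* (b :* i) := (b :* b) :* (i :* i)) (λ _ → refl) (b ∷ i ∷ []) ⟩
      (b ⊗ b) ⊗ (i ⊗ i)       ≈⟨ ⊗-cong (≈-refl {b ⊗ b}) (proj₂ √-1) ⟩
      (b ⊗ b) ⊗ neg 1         ≈⟨ solve 1 (λ x → x :* (:- :1) := :- x) (λ _ → refl) (b ⊗ b ∷ []) ⟩
      neg (b ⊗ b)             ∎)
      where
      open ≈-Reasoning
      √-1 = ∃√-1 Q Q>0 4Q≡p-1
      i = proj₁ √-1

    module SplitNode (2<p : 2 < p) (c : ℕ) (c²≈-a : c ⊗ c ≈ neg a) (a≉0 : a ≉ 0) where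

      2≉0 : 2 ≉ 0
      2≉0 = ≢0⇒≉0 2<p (λ ())

      c≉0 : c ≉ 0
      c≉0 c≈0 = a≉0 (begin
        a             ≈⟨ solve 1 (λ a → a := :- (:- a)) (λ _ → refl) (a ∷ []) ⟩
        neg (neg a)   ≈⟨ neg-cong c²≈-a ⟨
        neg (c ⊗ c)   ≈⟨ neg-cong (⊗-≈0ˡ c c≈0) ⟩
        neg 0         ≈⟨ solve 0 (:- :0 := :0) (λ _ → refl) [] ⟩
        0             ∎)
        where open ≈-Reasoning

      2c≉0 : 2 ⊗ c ≉ 0
      2c≉0 = ⊗-≉0 2≉0 c≉0

      a≈-c² : a ≈ neg (c ⊗ c)
      a≈-c² = trans (solve 1 (λ a → a := :- (:- a)) (λ _ → refl) (a ∷ [])) (neg-cong (sym c²≈-a))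

      t-1≉0 : ∀ {t} → t < p → t ≢ 1 → t ⊖ 1 ≉ 0
      t-1≉0 t<p t≢1 = t≢1 ∘ ≈⇒≡ t<p 1<p ∘ ⊖≈0⇒≈

      U : ℕ → ℕ
      U t = c ⊗ ((t ⊕ 1) ⊘ (t ⊖ 1))

      U-def : ∀ {t} → t < p → t ≢ 1 → U t ⊗ (t ⊖ 1) ≈ c ⊗ (t ⊕ 1)
      U-def {t} t<p t≢1 = trans
        (solve 3 (λ c q d → (c :* q) :* d := c :* (q :* d)) (λ _ → refl) (c ∷ (t ⊕ 1) ⊘ (t ⊖ 1) ∷ t ⊖ 1 ∷ []))
        (⊗-cong (≈-refl {c}) (⊘-⊗ (t-1≉0 t<p t≢1)))

      module _ {s t} (s<p : s < p) (s≢1 : s ≢ 1) (t<p : t < p) (t≢1 : t ≢ 1) where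

        U-⊖ : (U s ⊖ U t) ⊗ ((s ⊖ 1) ⊗ (t ⊖ 1)) ≈ (2 ⊗ c) ⊗ (t ⊖ s)
        U-⊖ = trans
          (solve 4 (λ u₁ u₂ s t → (u₁ :- u₂) :* ((s :- :1) :* (t :- :1))
                                   := ((u₁ :* (s :- :1)) :* (t :- :1)) :- ((u₂ :* (t :- :1)) :* (s :- :1)))
                   (λ _ → refl) (U s ∷ U t ∷ s ∷ t ∷ []))
          (trans (⊖-cong (⊗-cong (U-def s<p s≢1) (≈-refl {t ⊖ 1})) (⊗-cong (U-def t<p t≢1) (≈-refl {s ⊖ 1})))
          (solve 3 (λ c s t → ((c :* (s :+ :1)) :* (t :- :1)) :- ((c :* (t :+ :1)) :* (s :- :1)) := (:2 :* c) :* (t :- s))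
                   (λ _ → refl) (c ∷ s ∷ t ∷ [])))

        U-⊕ : (U s ⊕ U t) ⊗ ((s ⊖ 1) ⊗ (t ⊖ 1)) ≈ (2 ⊗ c) ⊗ ((s ⊗ t) ⊖ 1)
        U-⊕ = trans
          (solve 4 (λ u₁ u₂ s t → (u₁ :+ u₂) :* ((s :- :1) :* (t :- :1))
                                   := ((u₁ :* (s :- :1)) :* (t :- :1)) :+ ((u₂ :* (t :- :1)) :* (s :- :1)))
                   (λ _ → refl) (U s ∷ U t ∷ s ∷ t ∷ []))
          (trans (⊕-cong (⊗-cong (U-def s<p s≢1) (≈-refl {t ⊖ 1})) (⊗-cong (U-def t<p t≢1) (≈-refl {s ⊖ 1})))
          (solve 3 (λ c s t → ((c :* (s :+ :1)) :* (t :- :1)) :+ ((c :* (t :+ :1)) :* (s :- :1)) := (:2 :* c) :* ((s :* t) :- :1))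
                   (λ _ → refl) (c ∷ s ∷ t ∷ [])))

        U-injective : U s ≈ U t → s ≡ t
        U-injective Us≈Ut = Sum.[ ⊥-elim ∘ 2c≉0 , sym ∘ ≈⇒≡ t<p s<p ∘ ⊖≈0⇒≈ ]′
          (⊗≈0⇒ (trans (sym U-⊖) (⊗-≈0ˡ ((s ⊖ 1) ⊗ (t ⊖ 1)) (≈⇒⊖≈0 Us≈Ut))))

        U-⊕≈0⇒st≡1 : U s ⊕ U t ≈ 0 → s ⊗ t ≡ 1
        U-⊕≈0⇒st≡1 Us+Ut≈0 = Sum.[ ⊥-elim ∘ 2c≉0 , ≈⇒≡ (⊗<p s t) 1<p ∘ ⊖≈0⇒≈ ]′
          (⊗≈0⇒ (trans (sym U-⊕) (⊗-≈0ˡ ((s ⊖ 1) ⊗ (t ⊖ 1)) Us+Ut≈0)))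

        st≡1⇒U-⊕≈0 : s ⊗ t ≡ 1 → U s ⊕ U t ≈ 0
        st≡1⇒U-⊕≈0 st≡1 = Sum.[ id , ⊥-elim ∘ ⊗-≉0 (t-1≉0 s<p s≢1) (t-1≉0 t<p t≢1) ]′
          (⊗≈0⇒ (trans U-⊕ (⊗-≈0ʳ (2 ⊗ c) (≈⇒⊖≈0 (cong (_% p) st≡1)))))

        -- U turns multiplication into the addition law u₃ = (u₁u₂ - a)/(u₁ + u₂) of the curve.
        U-⊗ : s ⊗ t ≢ 1 → U (s ⊗ t) ⊗ (U s ⊕ U t) ≈ (U s ⊗ U t) ⊖ a
        U-⊗ st≢1 = ⊗-cancelʳ M≉0 (trans lhs·M (sym rhs·M))
          where
          A = s ⊖ 1
          B = t ⊖ 1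
          C = (s ⊗ t) ⊖ 1
          M = A ⊗ (B ⊗ C)
          u₁ = U s
          u₂ = U t
          u₃ = U (s ⊗ t)
          M≉0 : M ≉ 0
          M≉0 = ⊗-≉0 (t-1≉0 s<p s≢1) (⊗-≉0 (t-1≉0 t<p t≢1) (t-1≉0 (⊗<p s t) st≢1))
          common = (c ⊗ ((s ⊗ t) ⊕ 1)) ⊗ (((c ⊗ (s ⊕ 1)) ⊗ B) ⊕ ((c ⊗ (t ⊕ 1)) ⊗ A))
          lhs·M : (u₃ ⊗ (u₁ ⊕ u₂)) ⊗ M ≈ common
          lhs·M = trans
            (solve 5 (λ u₃ u₁ u₂ s t → (u₃ :* (u₁ :+ u₂)) :* ((s :- :1) :* ((t :- :1) :* ((s :* t) :- :1)))
                                       := (u₃ :* ((s :* t) :- :1)) :* (((u₁ :* (s :- :1)) :* (t :- :1)) :+ ((u₂ :* (t :- :1)) :* (s :- :1))))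
                   (λ _ → refl) (u₃ ∷ u₁ ∷ u₂ ∷ s ∷ t ∷ []))
            (⊗-cong (U-def (⊗<p s t) st≢1) (⊕-cong (⊗-cong (U-def s<p s≢1) (≈-refl {B})) (⊗-cong (U-def t<p t≢1) (≈-refl {A}))))
          rhs·M : ((u₁ ⊗ u₂) ⊖ a) ⊗ M ≈ common
          rhs·M = trans
            (solve 5 (λ u₁ u₂ s t a → ((u₁ :* u₂) :- a) :* ((s :- :1) :* ((t :- :1) :* ((s :* t) :- :1)))
                                       := (((u₁ :* (s :- :1)) :* (u₂ :* (t :- :1))) :- (a :* ((s :- :1) :* (t :- :1)))) :* ((s :* t) :- :1))
                   (λ _ → refl) (u₁ ∷ u₂ ∷ s ∷ t ∷ a ∷ []))
            (trans (⊗-cong (⊖-cong (⊗-cong (U-def s<p s≢1) (U-def t<p t≢1)) (⊗-cong a≈-c² (≈-refl {A ⊗ B}))) (≈-refl {C}))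
            (solve 3 (λ c s t → (((c :* (s :+ :1)) :* (c :* (t :+ :1))) :- ((:- (c :* c)) :* ((s :- :1) :* (t :- :1)))) :* ((s :* t) :- :1)
                                 := (c :* ((s :* t) :+ :1)) :* (((c :* (s :+ :1)) :* (t :- :1)) :+ ((c :* (t :+ :1)) :* (s :- :1))))
                   (λ _ → refl) (c ∷ s ∷ t ∷ [])))

      X : ℕ → ℕ
      X u = u ⊗ u

      Y : ℕ → ℕ
      Y u = u ⊗ ((u ⊗ u) ⊕ a)

      X-cong : ∀ {u v} → u ≈ v → X u ≈ X v
      X-cong u≈v = ⊗-cong u≈v u≈v

      Y-cong : ∀ {u v} → u ≈ v → Y u ≈ Y v
      Y-cong {u} {v} u≈v = ⊗-cong u≈v (⊕-cong (⊗-cong u≈v u≈v) (≈-refl {a}))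

      point : ℕ → Pt
      point u = aff (X u) (Y u)

      ⊕≈0⇒≈neg : ∀ {u₁ u₂} → u₁ ⊕ u₂ ≈ 0 → u₂ ≈ neg u₁
      ⊕≈0⇒≈neg {u₁} {u₂} u₁+u₂≈0 = trans (solve 2 (λ u₁ u₂ → u₂ := (u₁ :+ u₂) :- u₁) (λ _ → refl) (u₁ ∷ u₂ ∷ []))
        (trans (⊖-cong u₁+u₂≈0 (≈-refl {u₁})) (solve 1 (λ u₁ → :0 :- u₁ := :- u₁) (λ _ → refl) (u₁ ∷ [])))

      Y-odd : ∀ {u₁ u₂} → u₁ ⊕ u₂ ≈ 0 → Y u₁ ⊕ Y u₂ ≈ 0
      Y-odd {u₁} {u₂} u₁+u₂≈0 = trans (⊕-cong (≈-refl {Y u₁}) (Y-cong (⊕≈0⇒≈neg u₁+u₂≈0)))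
        (solve 2 (λ u a → (u :* ((u :* u) :+ a)) :+ ((:- u) :* (((:- u) :* (:- u)) :+ a)) := :0) (λ _ → refl) (u₁ ∷ a ∷ []))

      -- If u₁ + u₂ ≉ 0, the line through the points with parameters u₁, u₂ has slope (u₁² + u₁u₂ + u₂² + a)/(u₁ + u₂)
      -- and meets the curve a third time at the point with parameter (u₁u₂ - a)/(u₁ + u₂).
      module ThirdPoint {u₁ u₂ u₃ k x₃} (D≉0 : u₁ ⊕ u₂ ≉ 0)
        (slope : k ⊗ (u₁ ⊕ u₂) ≈ (((u₁ ⊗ u₁) ⊕ (u₁ ⊗ u₂)) ⊕ (u₂ ⊗ u₂)) ⊕ a)
        (param : u₃ ⊗ (u₁ ⊕ u₂) ≈ (u₁ ⊗ u₂) ⊖ a)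
        (abscissa : x₃ ≈ ((k ⊗ k) ⊖ (2 ⊗ a)) ⊖ (X u₁ ⊕ X u₂)) where

        private
          D  = u₁ ⊕ u₂
          D² = D ⊗ D
          W  = (u₁ ⊗ u₂) ⊖ a
          D²≉0 : D² ≉ 0
          D²≉0 = ⊗-≉0 D≉0 D≉0

          x₃·D² : x₃ ⊗ D² ≈ W ⊗ W
          x₃·D² = trans (⊗-cong abscissa (≈-refl {D²}))
            (trans (solve 4 (λ k u₁ u₂ a → ((((k :* k) :- (:2 :* a)) :- ((u₁ :* u₁) :+ (u₂ :* u₂))) :* ((u₁ :+ u₂) :* (u₁ :+ u₂)))
                                           := ((k :* (u₁ :+ u₂)) :* (k :* (u₁ :+ u₂)))
                                              :- (((:2 :* a) :+ ((u₁ :* u₁) :+ (u₂ :* u₂))) :* ((u₁ :+ u₂) :* (u₁ :+ u₂))))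
                           (λ _ → refl) (k ∷ u₁ ∷ u₂ ∷ a ∷ []))
            (trans (⊖-cong (⊗-cong slope slope) (≈-refl {((2 ⊗ a) ⊕ (X u₁ ⊕ X u₂)) ⊗ D²}))
            (solve 3 (λ u₁ u₂ a → let S = ((((u₁ :* u₁) :+ (u₁ :* u₂)) :+ (u₂ :* u₂)) :+ a) in
                                   (S :* S) :- (((:2 :* a) :+ ((u₁ :* u₁) :+ (u₂ :* u₂))) :* ((u₁ :+ u₂) :* (u₁ :+ u₂)))
                                   := ((u₁ :* u₂) :- a) :* ((u₁ :* u₂) :- a))
                     (λ _ → refl) (u₁ ∷ u₂ ∷ a ∷ []))))

        x₃≈Xu₃ : x₃ ≈ X u₃
        x₃≈Xu₃ = ⊗-cancelʳ D²≉0 (trans x₃·D² (sym (trans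
          (solve 2 (λ u₃ d → (u₃ :* u₃) :* (d :* d) := (u₃ :* d) :* (u₃ :* d)) (λ _ → refl) (u₃ ∷ D ∷ []))
          (⊗-cong param param))))

        y₃≈Yu₃ : (k ⊗ (X u₁ ⊖ x₃)) ⊖ Y u₁ ≈ Y u₃
        y₃≈Yu₃ = ⊗-cancelʳ (⊗-≉0 D≉0 D²≉0) (trans y₃·D³ (sym Yu₃·D³))
          where
          RHS = W ⊗ ((W ⊗ W) ⊕ (a ⊗ D²))
          y₃·D³ : ((k ⊗ (X u₁ ⊖ x₃)) ⊖ Y u₁) ⊗ (D ⊗ D²) ≈ RHS
          y₃·D³ = trans
            (solve 5 (λ k u₁ u₂ a x₃ → let D = u₁ :+ u₂ ; Y₁ = u₁ :* ((u₁ :* u₁) :+ a) in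
                                       ((k :* ((u₁ :* u₁) :- x₃)) :- Y₁) :* (D :* (D :* D))
                                       := ((k :* D) :* (((u₁ :* u₁) :* (D :* D)) :- (x₃ :* (D :* D)))) :- (Y₁ :* (D :* (D :* D))))
                   (λ _ → refl) (k ∷ u₁ ∷ u₂ ∷ a ∷ x₃ ∷ []))
            (trans (⊖-cong (⊗-cong slope (⊖-cong (≈-refl {X u₁ ⊗ D²}) x₃·D²)) (≈-refl {Y u₁ ⊗ (D ⊗ D²)}))
            (solve 3 (λ u₁ u₂ a → let D = u₁ :+ u₂ ; W = (u₁ :* u₂) :- a ; Y₁ = u₁ :* ((u₁ :* u₁) :+ a)
                                        ; S = (((u₁ :* u₁) :+ (u₁ :* u₂)) :+ (u₂ :* u₂)) :+ a in
                                   (S :* (((u₁ :* u₁) :* (D :* D)) :- (W :* W))) :- (Y₁ :* (D :* (D :* D)))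
                                   := W :* ((W :* W) :+ (a :* (D :* D))))
                     (λ _ → refl) (u₁ ∷ u₂ ∷ a ∷ [])))
          Yu₃·D³ : Y u₃ ⊗ (D ⊗ D²) ≈ RHS
          Yu₃·D³ = trans
            (solve 3 (λ u₃ d a → (u₃ :* ((u₃ :* u₃) :+ a)) :* (d :* (d :* d))
                                  := (u₃ :* d) :* (((u₃ :* d) :* (u₃ :* d)) :+ (a :* (d :* d))))
                   (λ _ → refl) (u₃ ∷ D ∷ a ∷ []))
            (⊗-cong param (⊕-cong (⊗-cong param param) (≈-refl {a ⊗ D²})))

      private
        chord-slope : ℕ → ℕ → ℕ → ℕ → ℕ
        chord-slope x₁ y₁ x₂ y₂ = (y₂ ⊖ y₁) ⊘ (x₂ ⊖ x₁)

        tangent-slope : ℕ → ℕ → ℕ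
        tangent-slope x₁ y₁ = ((x₁ ⊕ a) ⊗ ((3 ⊗ x₁) ⊕ a)) ⊘ (2 ⊗ y₁)

        third-y : ℕ → ℕ → ℕ → ℕ → ℕ
        third-y k x₁ x₃ y₁ = (k ⊗ (x₁ ⊖ x₃)) ⊖ y₁

      +E-chord : ∀ x₁ y₁ x₂ y₂ → x₁ % p ≢ x₂ % p →
        let k = chord-slope x₁ y₁ x₂ y₂ ; x₃ = (((k ⊗ k) ⊖ (2 ⊗ a)) ⊖ x₁) ⊖ x₂ in
        aff x₁ y₁ +E aff x₂ y₂ ≡ aff x₃ (third-y k x₁ x₃ y₁)
      +E-chord x₁ y₁ x₂ y₂ x₁≢x₂ with x₁ % p ≟ x₂ % p
      ... | yes x₁≡x₂ = ⊥-elim (x₁≢x₂ x₁≡x₂)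
      ... | no  _     = refl

      +E-vertical : ∀ x₁ y₁ x₂ y₂ → x₁ % p ≡ x₂ % p → y₁ ⊕ y₂ ≡ 0 → aff x₁ y₁ +E aff x₂ y₂ ≡ ∞
      +E-vertical x₁ y₁ x₂ y₂ x₁≡x₂ y₁+y₂≡0 with x₁ % p ≟ x₂ % p
      ... | no x₁≢x₂ = ⊥-elim (x₁≢x₂ x₁≡x₂)
      ... | yes _ with y₁ ⊕ y₂ ≟ 0
      ...   | yes _         = refl
      ...   | no y₁+y₂≢0    = ⊥-elim (y₁+y₂≢0 y₁+y₂≡0)

      +E-tangent : ∀ x₁ y₁ x₂ y₂ → x₁ % p ≡ x₂ % p → y₁ ⊕ y₂ ≢ 0 →
        let k = tangent-slope x₁ y₁ ; x₃ = ((k ⊗ k) ⊖ (2 ⊗ a)) ⊖ (2 ⊗ x₁) in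
        aff x₁ y₁ +E aff x₂ y₂ ≡ aff x₃ (third-y k x₁ x₃ y₁)
      +E-tangent x₁ y₁ x₂ y₂ x₁≡x₂ y₁+y₂≢0 with x₁ % p ≟ x₂ % p
      ... | no x₁≢x₂ = ⊥-elim (x₁≢x₂ x₁≡x₂)
      ... | yes _ with y₁ ⊕ y₂ ≟ 0
      ...   | yes y₁+y₂≡0 = ⊥-elim (y₁+y₂≢0 y₁+y₂≡0)
      ...   | no _        = refl

      -- The factors vanish at the tangent directions u = ±c of the node.
      X⊕a≈[u-c][u+c] : ∀ u → X u ⊕ a ≈ (u ⊖ c) ⊗ (u ⊕ c)
      X⊕a≈[u-c][u+c] u = begin
        X u ⊕ a                ≈⟨ ⊕-cong (≈-refl {X u}) a≈-c² ⟩
        X u ⊕ neg (c ⊗ c)      ≈⟨ solve 2 (λ u c → (u :* u) :- (c :* c) := (u :- c) :* (u :+ c)) (λ _ → refl) (u ∷ c ∷ []) ⟩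
        (u ⊖ c) ⊗ (u ⊕ c)      ∎
        where open ≈-Reasoning

      module _ {t} (t<p : t < p) (t≢1 : t ≢ 1) where

        U≉c : U t ⊖ c ≉ 0
        U≉c Ut-c≈0 = 2≉0 (⊗-cancelˡ c≉0 (begin
          c ⊗ 2                                     ≈⟨ solve 2 (λ c t → c :* :2 := (c :* (t :+ :1)) :- (c :* (t :- :1)))
                                                                 (λ _ → refl) (c ∷ t ∷ []) ⟩
          (c ⊗ (t ⊕ 1)) ⊖ (c ⊗ (t ⊖ 1))             ≈⟨ ⊖-cong (U-def t<p t≢1) (⊗-cong (⊖≈0⇒≈ Ut-c≈0) (≈-refl {t ⊖ 1})) ⟨
          (U t ⊗ (t ⊖ 1)) ⊖ (U t ⊗ (t ⊖ 1))         ≈⟨ ≈⇒⊖≈0 (≈-refl {U t ⊗ (t ⊖ 1)}) ⟩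
          0                                         ≈⟨ ⊗-≈0ʳ c (≈-refl {0}) ⟨
          c ⊗ 0                                     ∎))
          where open ≈-Reasoning

        U≉-c : t ≢ 0 → U t ⊕ c ≉ 0
        U≉-c t≢0 Ut+c≈0 = Sum.[ 2c≉0 , t≢0 ∘ ≈⇒≡ t<p 0<p ]′ (⊗≈0⇒ (begin
          (2 ⊗ c) ⊗ t                               ≈⟨ solve 2 (λ c t → (:2 :* c) :* t := (c :* (t :+ :1)) :- ((:- c) :* (t :- :1)))
                                                                 (λ _ → refl) (c ∷ t ∷ []) ⟩
          (c ⊗ (t ⊕ 1)) ⊖ (neg c ⊗ (t ⊖ 1))         ≈⟨ ⊖-cong (U-def t<p t≢1) (⊗-cong Ut≈-c (≈-refl {t ⊖ 1})) ⟨
          (U t ⊗ (t ⊖ 1)) ⊖ (U t ⊗ (t ⊖ 1))         ≈⟨ ≈⇒⊖≈0 (≈-refl {U t ⊗ (t ⊖ 1)}) ⟩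
          0                                         ∎))
          where
          open ≈-Reasoning
          Ut≈-c : U t ≈ neg c
          Ut≈-c = ⊕≈0⇒≈neg (trans (⊕-comm c (U t)) Ut+c≈0)

        nonsingular : t ≢ 0 → X (U t) ⊕ a ≉ 0
        nonsingular t≢0 = ⊗-≉0 U≉c (U≉-c t≢0) ∘ trans (sym (X⊕a≈[u-c][u+c] (U t)))

      φ : ℕ → Pt
      φ t with t ≟ 1
      ... | yes _ = ∞
      ... | no  _ = point (U t)

      φ-≢1 : ∀ {t} → t ≢ 1 → φ t ≡ point (U t)
      φ-≢1 {t} t≢1 with t ≟ 1
      ... | yes t≡1 = ⊥-elim (t≢1 t≡1)
      ... | no  _   = refl

      φ≡∞⇒≡1 : ∀ {t} → φ t ≡ ∞ → t ≡ 1
      φ≡∞⇒≡1 {t} φt≡∞ with t ≟ 1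
      ... | yes t≡1 = t≡1
      ... | no  _   with () ← φt≡∞

      aff≡point : ∀ {x y} u → x < p → y < p → x ≈ X u → y ≈ Y u → aff x y ≡ point u
      aff≡point u x<p y<p x≈Xu y≈Yu = cong₂ aff (≈⇒≡ x<p (⊗<p u u) x≈Xu) (≈⇒≡ y<p (⊗<p u ((u ⊗ u) ⊕ a)) y≈Yu)

      module _ {s} (s<p : s < p) (s≢0 : s ≢ 0) (s≢1 : s ≢ 1) where

        private
          u = U s
          D = u ⊕ u

        Y+Y≢0⇒u+u≉0 : Y u ⊕ Y u ≢ 0 → D ≉ 0
        Y+Y≢0⇒u+u≉0 2Y≢0 = 2Y≢0 ∘ ≈⇒≡ (⊕<p (Y u) (Y u)) 0<p ∘ Y-odd {u} {u}

        point-double≡φ : Y u ⊕ Y u ≢ 0 → point u +E point u ≡ φ (s ⊗ s)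
        point-double≡φ 2Y≢0 = begin
          point u +E point u             ≡⟨ +E-tangent (X u) (Y u) (X u) (Y u) refl 2Y≢0 ⟩
          aff x₃ (third-y k (X u) x₃ (Y u)) ≡⟨ aff≡point (U (s ⊗ s)) (⊕<p _ (neg (2 ⊗ X u))) (⊕<p _ (neg (Y u))) x₃≈Xu₃ y₃≈Yu₃ ⟩
          point (U (s ⊗ s))              ≡⟨ φ-≢1 s²≢1 ⟨
          φ (s ⊗ s)                      ∎
          where
          open ≡-Reasoning
          s²≢1 : s ⊗ s ≢ 1
          s²≢1 = Y+Y≢0⇒u+u≉0 2Y≢0 ∘ st≡1⇒U-⊕≈0 s<p s≢1 s<p s≢1
          k  = tangent-slope (X u) (Y u)
          x₃ = ((k ⊗ k) ⊖ (2 ⊗ a)) ⊖ (2 ⊗ X u)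
          2Yu≉0 : 2 ⊗ Y u ≉ 0
          2Yu≉0 = 2Y≢0 ∘ ≈⇒≡ (⊕<p (Y u) (Y u)) 0<p
                       ∘ trans (solve 1 (λ y → y :+ y := :2 :* y) (λ _ → refl) (Y u ∷ []))
          slope : k ⊗ D ≈ (((u ⊗ u) ⊕ (u ⊗ u)) ⊕ (u ⊗ u)) ⊕ a
          slope = ⊗-cancelʳ (nonsingular s<p s≢1 s≢0) (trans
            (solve 3 (λ k u a → (k :* (u :+ u)) :* ((u :* u) :+ a) := k :* (:2 :* (u :* ((u :* u) :+ a))))
                   (λ _ → refl) (k ∷ u ∷ a ∷ []))
            (trans (⊘-⊗ 2Yu≉0)
            (solve 2 (λ u a → ((u :* u) :+ a) :* ((:3 :* (u :* u)) :+ a) := ((((u :* u) :+ (u :* u)) :+ (u :* u)) :+ a) :* ((u :* u) :+ a))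
                   (λ _ → refl) (u ∷ a ∷ []))))
          abscissa : x₃ ≈ ((k ⊗ k) ⊖ (2 ⊗ a)) ⊖ (X u ⊕ X u)
          abscissa = solve 3 (λ k a x → ((k :* k) :- (:2 :* a)) :- (:2 :* x) := ((k :* k) :- (:2 :* a)) :- (x :+ x))
                           (λ _ → refl) (k ∷ a ∷ X u ∷ [])
          open ThirdPoint {u} {u} {U (s ⊗ s)} {k} {x₃} (Y+Y≢0⇒u+u≉0 2Y≢0) slope (U-⊗ s<p s≢1 s<p s≢1 s²≢1) abscissa

      module _ {s t} (s<p : s < p) (s≢1 : s ≢ 1) (t<p : t < p) (t≢1 : t ≢ 1) where

        private
          u₁ = U s
          u₂ = U t

        point-chord≡φ : X u₁ % p ≢ X u₂ % p → point u₁ +E point u₂ ≡ φ (s ⊗ t)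
        point-chord≡φ X≉X = begin
          point u₁ +E point u₂                 ≡⟨ +E-chord (X u₁) (Y u₁) (X u₂) (Y u₂) X≉X ⟩
          aff x₃ (third-y k (X u₁) x₃ (Y u₁))  ≡⟨ aff≡point (U (s ⊗ t)) (⊕<p _ (neg (X u₂))) (⊕<p _ (neg (Y u₁)))
                                                             x₃≈Xu₃ y₃≈Yu₃ ⟩
          point (U (s ⊗ t))                    ≡⟨ φ-≢1 st≢1 ⟨
          φ (s ⊗ t)                            ∎
          where
          open ≡-Reasoning
          X₂-X₁≈ : X u₂ ⊖ X u₁ ≈ (u₂ ⊖ u₁) ⊗ (u₁ ⊕ u₂)
          X₂-X₁≈ = solve 2 (λ u₁ u₂ → (u₂ :* u₂) :- (u₁ :* u₁) := (u₂ :- u₁) :* (u₁ :+ u₂)) (λ _ → refl) (u₁ ∷ u₂ ∷ [])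
          X₂-X₁≉0 : X u₂ ⊖ X u₁ ≉ 0
          X₂-X₁≉0 = X≉X ∘ sym ∘ ⊖≈0⇒≈
          D≉0 : u₁ ⊕ u₂ ≉ 0
          D≉0 = X₂-X₁≉0 ∘ trans X₂-X₁≈ ∘ ⊗-≈0ʳ (u₂ ⊖ u₁)
          u₂-u₁≉0 : u₂ ⊖ u₁ ≉ 0
          u₂-u₁≉0 = X₂-X₁≉0 ∘ trans X₂-X₁≈ ∘ ⊗-≈0ˡ (u₁ ⊕ u₂)
          st≢1 : s ⊗ t ≢ 1
          st≢1 = X≉X ∘ X-opposite ∘ st≡1⇒U-⊕≈0 s<p s≢1 t<p t≢1
            where
            X-opposite : u₁ ⊕ u₂ ≈ 0 → X u₁ ≈ X u₂
            X-opposite D≈0 = trans (solve 1 (λ u → u :* u := (:- u) :* (:- u)) (λ _ → refl) (u₁ ∷ []))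
                                   (sym (X-cong (⊕≈0⇒≈neg D≈0)))
          k  = chord-slope (X u₁) (Y u₁) (X u₂) (Y u₂)
          x₃ = (((k ⊗ k) ⊖ (2 ⊗ a)) ⊖ X u₁) ⊖ X u₂
          slope : k ⊗ (u₁ ⊕ u₂) ≈ (((u₁ ⊗ u₁) ⊕ (u₁ ⊗ u₂)) ⊕ (u₂ ⊗ u₂)) ⊕ a
          slope = ⊗-cancelʳ u₂-u₁≉0 (trans
            (solve 3 (λ k u₁ u₂ → (k :* (u₁ :+ u₂)) :* (u₂ :- u₁) := k :* ((u₂ :* u₂) :- (u₁ :* u₁)))
                   (λ _ → refl) (k ∷ u₁ ∷ u₂ ∷ []))
            (trans (⊘-⊗ X₂-X₁≉0)
            (solve 3 (λ u₁ u₂ a → (u₂ :* ((u₂ :* u₂) :+ a)) :- (u₁ :* ((u₁ :* u₁) :+ a))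
                                   := ((((u₁ :* u₁) :+ (u₁ :* u₂)) :+ (u₂ :* u₂)) :+ a) :* (u₂ :- u₁))
                   (λ _ → refl) (u₁ ∷ u₂ ∷ a ∷ []))))
          abscissa : x₃ ≈ ((k ⊗ k) ⊖ (2 ⊗ a)) ⊖ (X u₁ ⊕ X u₂)
          abscissa = solve 4 (λ k a x₁ x₂ → (((k :* k) :- (:2 :* a)) :- x₁) :- x₂ := ((k :* k) :- (:2 :* a)) :- (x₁ :+ x₂))
                           (λ _ → refl) (k ∷ a ∷ X u₁ ∷ X u₂ ∷ [])
          open ThirdPoint {u₁} {u₂} {U (s ⊗ t)} {k} {x₃} D≉0 slope (U-⊗ s<p s≢1 t<p t≢1 st≢1) abscissa

      module _ {s t} (s<p : s < p) (s≢0 : s ≢ 0) (s≢1 : s ≢ 1) (t<p : t < p) (t≢1 : t ≢ 1) where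

        private
          u₁ = U s
          u₂ = U t

        X≡X⇒u₁≈±u₂ : X u₁ % p ≡ X u₂ % p → u₁ ⊖ u₂ ≈ 0 ⊎ u₁ ⊕ u₂ ≈ 0
        X≡X⇒u₁≈±u₂ X≡X = ⊗≈0⇒ (trans
          (solve 2 (λ u₁ u₂ → (u₁ :- u₂) :* (u₁ :+ u₂) := (u₁ :* u₁) :- (u₂ :* u₂)) (λ _ → refl) (u₁ ∷ u₂ ∷ []))
          (≈⇒⊖≈0 X≡X))

        -- 2 Y u = 2u(u² + a), and u² + a ≉ 0.
        Y+Y≈0⇒u₁+u₂≈0 : u₁ ≈ u₂ → Y u₁ ⊕ Y u₂ ≈ 0 → u₁ ⊕ u₂ ≈ 0
        Y+Y≈0⇒u₁+u₂≈0 u₁≈u₂ Y+Y≈0 = Sum.[ ⊥-elim ∘ 2≉0 , u≈0∨X+a≈0 ∘ ⊗≈0⇒ ]′ (⊗≈0⇒ 2Y≈0)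
          where
          2Y≈0 : 2 ⊗ Y u₁ ≈ 0
          2Y≈0 = trans (solve 1 (λ y → :2 :* y := y :+ y) (λ _ → refl) (Y u₁ ∷ [])) (trans (⊕-cong (≈-refl {Y u₁}) (Y-cong u₁≈u₂)) Y+Y≈0)
          u≈0∨X+a≈0 : u₁ ≈ 0 ⊎ X u₁ ⊕ a ≈ 0 → u₁ ⊕ u₂ ≈ 0
          u≈0∨X+a≈0 (inj₁ u₁≈0)   = trans (⊕-cong u₁≈0 (trans (sym u₁≈u₂) u₁≈0)) (solve 0 (:0 :+ :0 := :0) (λ _ → refl) [])
          u≈0∨X+a≈0 (inj₂ X+a≈0) = ⊥-elim (nonsingular s<p s≢1 s≢0 X+a≈0)

        point+point≡φ : point u₁ +E point u₂ ≡ φ (s ⊗ t)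
        point+point≡φ = by-abscissae (X u₁ % p ≟ X u₂ % p)
          where
          st≡1 : Y u₁ ⊕ Y u₂ ≈ 0 → u₁ ⊖ u₂ ≈ 0 ⊎ u₁ ⊕ u₂ ≈ 0 → s ⊗ t ≡ 1
          st≡1 Y+Y≈0 (inj₁ u₁-u₂≈0) = U-⊕≈0⇒st≡1 s<p s≢1 t<p t≢1 (Y+Y≈0⇒u₁+u₂≈0 (⊖≈0⇒≈ u₁-u₂≈0) Y+Y≈0)
          st≡1 _     (inj₂ u₁+u₂≈0) = U-⊕≈0⇒st≡1 s<p s≢1 t<p t≢1 u₁+u₂≈0

          tangent : Y u₁ ⊕ Y u₂ ≢ 0 → u₁ ⊖ u₂ ≈ 0 → point u₁ +E point u₂ ≡ φ (s ⊗ t)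
          tangent Y+Y≢0 u₁-u₂≈0 = subst (λ t′ → point u₁ +E point (U t′) ≡ φ (s ⊗ t′)) s≡t
                                    (point-double≡φ s<p s≢0 s≢1 (subst (λ t′ → Y u₁ ⊕ Y (U t′) ≢ 0) (sym s≡t) Y+Y≢0))
            where
            s≡t : s ≡ t
            s≡t = U-injective s<p s≢1 t<p t≢1 (⊖≈0⇒≈ u₁-u₂≈0)

          by-abscissae : Dec (X u₁ % p ≡ X u₂ % p) → point u₁ +E point u₂ ≡ φ (s ⊗ t)
          by-abscissae (no X≢X)  = point-chord≡φ s<p s≢1 t<p t≢1 X≢X
          by-abscissae (yes X≡X) = by-ordinates (Y u₁ ⊕ Y u₂ ≟ 0)
            where
            by-ordinates : Dec (Y u₁ ⊕ Y u₂ ≡ 0) → point u₁ +E point u₂ ≡ φ (s ⊗ t)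
            by-ordinates (yes Y+Y≡0) = trans (+E-vertical (X u₁) (Y u₁) (X u₂) (Y u₂) X≡X Y+Y≡0)
                                             (cong φ (sym (st≡1 (cong (_% p) Y+Y≡0) (X≡X⇒u₁≈±u₂ X≡X))))
            by-ordinates (no Y+Y≢0)  =
              Sum.[ tangent Y+Y≢0 , ⊥-elim ∘ Y+Y≢0 ∘ ≈⇒≡ (⊕<p (Y u₁) (Y u₂)) 0<p ∘ Y-odd {u₁} {u₂} ]′ (X≡X⇒u₁≈±u₂ X≡X)

      ⊗-identityˡ : ∀ {t} → t < p → 1 ⊗ t ≡ t
      ⊗-identityˡ {t} t<p = ≈⇒≡ (⊗<p 1 t) t<p (solve 1 (λ t → :1 :* t := t) (λ _ → refl) (t ∷ []))

      ⊗-identityʳ : ∀ {t} → t < p → t ⊗ 1 ≡ t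
      ⊗-identityʳ {t} t<p = ≈⇒≡ (⊗<p t 1) t<p (solve 1 (λ t → t :* :1 := t) (λ _ → refl) (t ∷ []))

      +E-identityʳ : ∀ P → P +E ∞ ≡ P
      +E-identityʳ ∞         = refl
      +E-identityʳ (aff x y) = refl

      φ-homo : ∀ {s t} → s ∈ units → t ∈ units → φ s +E φ t ≡ φ (s ⊗ t)
      φ-homo {s} {t} s∈ t∈ = by-s (s ≟ 1)
        where
        by-s : Dec (s ≡ 1) → φ s +E φ t ≡ φ (s ⊗ t)
        by-s (yes refl) = cong φ (sym (⊗-identityˡ (units-<p t∈)))
        by-s (no s≢1)   = by-t (t ≟ 1)
          where
          by-t : Dec (t ≡ 1) → φ s +E φ t ≡ φ (s ⊗ t)
          by-t (yes refl) = trans (+E-identityʳ (φ s)) (cong φ (sym (⊗-identityʳ (units-<p s∈))))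
          by-t (no t≢1)   = trans (cong₂ _+E_ (φ-≢1 s≢1) (φ-≢1 t≢1))
                                  (point+point≡φ (units-<p s∈) (proj₁ (∈units⁻ s∈)) s≢1 (units-<p t∈) t≢1)

      ·-φ : ∀ n {s} → s ∈ units → n · φ s ≡ φ (s ^ₚ n)
      ·-φ zero    s∈ = refl
      ·-φ (suc n) {s} s∈ = trans (cong (φ s +E_) (·-φ n s∈)) (φ-homo s∈ (^ₚ-∈units n s∈))

      ·-φ≡∞⇒^ₚ≈1 : ∀ n {s} → s ∈ units → n · φ s ≡ ∞ → s ^ₚ n ≈ 1
      ·-φ≡∞⇒^ₚ≈1 n s∈ nφs≡∞ = cong (_% p) (φ≡∞⇒≡1 (trans (sym (·-φ n s∈)) nφs≡∞))

      HasOrder4⇒ : ∀ {s} → s ∈ units → HasOrder (φ s) 4 → s ^ₚ 4 ≈ 1 × s ^ₚ 2 ≉ 1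
      HasOrder4⇒ {s} s∈ (_ , 4φs≡∞ , minimal) = ·-φ≡∞⇒^ₚ≈1 4 s∈ 4φs≡∞ ,
        λ s²≈1 → minimal {2} (s≤s (s≤s (s≤s z≤n))) z<s (trans (·-φ 2 s∈) (cong φ (≈⇒≡ (^ₚ<p s 2) 1<p s²≈1)))

      HasOrder4⇐ : ∀ {s} → s ∈ units → s ^ₚ 4 ≈ 1 → s ^ₚ 2 ≉ 1 → HasOrder (φ s) 4
      HasOrder4⇐ {s} s∈ s⁴≈1 s²≉1 = z<s , trans (·-φ 4 s∈) (cong φ (≈⇒≡ (^ₚ<p s 4) 1<p s⁴≈1)) ,
        λ {k} k<4 k>0 kφs≡∞ → sᵏ≉1 k k<4 k>0 (·-φ≡∞⇒^ₚ≈1 k s∈ kφs≡∞)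
        where
        s≉1 : s ≉ 1
        s≉1 s≈1 = s²≉1 (trans (^ₚ-cong 2 s≈1) (1^ₚ 2))
        sᵏ≉1 : ∀ k → k < 4 → 0 < k → s ^ₚ k ≉ 1
        sᵏ≉1 1 _ _ s¹≈1 = s≉1 (trans (sym (solve 1 (λ s → s :* :1 := s) (λ _ → refl) (s ∷ []))) s¹≈1)
        sᵏ≉1 2 _ _ s²≈1 = s²≉1 s²≈1
        sᵏ≉1 3 _ _ s³≈1 = s≉1 (begin
          s                  ≈⟨ solve 1 (λ s → s := s :* :1) (λ _ → refl) (s ∷ []) ⟩
          s ⊗ 1              ≈⟨ ⊗-cong (≈-refl {s}) s³≈1 ⟨
          s ⊗ (s ^ₚ 3)       ≈⟨ s⁴≈1 ⟩
          1                  ∎)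
          where open ≈-Reasoning
        sᵏ≉1 (suc (suc (suc (suc _)))) (s≤s (s≤s (s≤s (s≤s ())))) _

      module Event (e m : ℕ) (p-1≡2ᵉm : p ∸ 1 ≡ 2 ^ e * m) (e≥1 : 1 ≤ e) where

        -- τ t 0, τ t 1, … are successive squares, and τ t e ≈ 1 by Fermat.
        τ : ℕ → ℕ → ℕ
        τ t j = t ^ₚ (2 ^ j * m)

        τ-suc : ∀ t j → τ t (suc j) ≈ τ t j ^ₚ 2
        τ-suc t j = subst (λ n → t ^ₚ n ≈ τ t j ^ₚ 2) (lemma (2 ^ j) m) (^ₚ-* t (2 ^ j * m) 2)
          where
          lemma : ∀ x m → (x * m) * 2 ≡ (2 * x) * m
          lemma = ℕ-solve-∀

        τ-suc-suc : ∀ t i → τ t i ^ₚ 4 ≈ τ t (suc (suc i))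
        τ-suc-suc t i = trans (^ₚ-* (τ t i) 2 2) (trans (^ₚ-cong 2 (sym (τ-suc t i))) (sym (τ-suc t (suc i))))

        τ-≈1-stable : ∀ t → τ t 1 ≈ 1 → ∀ j → τ t (suc j) ≈ 1
        τ-≈1-stable t τ₁≈1 zero    = τ₁≈1
        τ-≈1-stable t τ₁≈1 (suc j) = trans (τ-suc t (suc j)) (trans (^ₚ-cong 2 (τ-≈1-stable t τ₁≈1 j)) (1^ₚ 2))

        Event⇒τ₁≉1 : ∀ {t} → t ∈ units → Event e m (φ t) → τ t 1 ≉ 1
        Event⇒τ₁≉1 {t} t∈ (i , _ , order4) τ₁≈1 =
          proj₂ (HasOrder4⇒ (^ₚ-∈units (2 ^ i * m) t∈) (subst (λ P → HasOrder P 4) (·-φ (2 ^ i * m) t∈) order4))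
                (trans (sym (τ-suc t i)) (τ-≈1-stable t τ₁≈1 i))

        LastNontrivial : ℕ → ℕ → Set
        LastNontrivial t j = ∃ λ i → i + 2 ≤ j × τ t (i + 2) ≈ 1 × τ t (suc i) ≉ 1

        last-nontrivial : ∀ t → τ t 1 ≉ 1 → ∀ j → 1 ≤ j → τ t j ≈ 1 → LastNontrivial t j
        last-nontrivial t τ₁≉1 1             _ τ₁≈1 = ⊥-elim (τ₁≉1 τ₁≈1)
        last-nontrivial t τ₁≉1 (suc (suc j)) _ τⱼ≈1 =
          extend (τ t (suc j) % p ≟ 1 % p) (last-nontrivial t τ₁≉1 (suc j) (s≤s z≤n))
          where
          extend : Dec (τ t (suc j) ≈ 1) → (τ t (suc j) ≈ 1 → LastNontrivial t (suc j)) → LastNontrivial t (suc (suc j))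
          extend (no τⱼ₋₁≉1) _  = j , ℕ.≤-reflexive (ℕ.+-comm j 2) , subst (λ n → τ t n ≈ 1) (ℕ.+-comm 2 j) τⱼ≈1 , τⱼ₋₁≉1
          extend (yes τⱼ₋₁≈1) ih with ih τⱼ₋₁≈1
          ... | i , i+2≤j+1 , rest = i , ℕ.m≤n⇒m≤1+n i+2≤j+1 , rest

        τ₁≉1⇒Event : ∀ {t} → t ∈ units → τ t 1 ≉ 1 → Event e m (φ t)
        τ₁≉1⇒Event {t} t∈ τ₁≉1 = i , i<e-1 ,
          subst (λ P → HasOrder P 4) (sym (·-φ (2 ^ i * m) t∈))
                (HasOrder4⇐ (^ₚ-∈units (2 ^ i * m) t∈)
                            (trans (τ-suc-suc t i) (subst (λ n → τ t n ≈ 1) (ℕ.+-comm i 2) τᵢ₊₂≈1))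
                            (τᵢ₊₁≉1 ∘ trans (τ-suc t i)))
          where
          τₑ≈1 : τ t e ≈ 1
          τₑ≈1 = subst (λ n → t ^ₚ n ≈ 1) p-1≡2ᵉm (fermat (units-≉0 t∈))
          found : LastNontrivial t e
          found = last-nontrivial t τ₁≉1 e e≥1 τₑ≈1
          i = proj₁ found
          i+2≤e : i + 2 ≤ e
          i+2≤e = proj₁ (proj₂ found)
          τᵢ₊₂≈1 : τ t (i + 2) ≈ 1
          τᵢ₊₂≈1 = proj₁ (proj₂ (proj₂ found))
          τᵢ₊₁≉1 : τ t (suc i) ≉ 1
          τᵢ₊₁≉1 = proj₂ (proj₂ (proj₂ found))
          i<e-1 : i < e ∸ 1
          i<e-1 = ℕ.∸-monoˡ-≤ 1 (ℕ.≤-trans (ℕ.≤-reflexive (ℕ.+-comm 2 i)) i+2≤e)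

      private
        row : ℕ → List Pt
        row x = map (aff x) (upTo p)

      ∈affinePts⁻ : ∀ {P} → P ∈ affinePts →
                    ∃ λ x → ∃ λ y → P ≡ aff x y × x < p × y < p × OnCurve x y × ¬ Singular x y
      ∈affinePts⁻ P∈ with ∈-filter⁻ _ {xs = concatMap row (upTo p)} P∈
      ... | P∈grid , (x , y , refl , on , ns) with find (∈-concatMap⁻ row {xs = upTo p} P∈grid)
      ... | x′ , x′∈ , P∈row with ∈-map⁻ (aff x′) P∈row
      ... | y′ , y′∈ , refl = x′ , y′ , refl , ∈-upTo⁻ x′∈ , ∈-upTo⁻ y′∈ , on , ns

      ∈affinePts⁺ : ∀ {x y} → x < p → y < p → OnCurve x y → ¬ Singular x y → aff x y ∈ affinePts
      ∈affinePts⁺ {x} {y} x<p y<p on ns = ∈-filter⁺ _ {xs = concatMap row (upTo p)}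
        (∈-concatMap⁺ row {xs = upTo p} (Any.map (λ { refl → ∈-map⁺ (aff x) (∈-upTo⁺ y<p) }) (∈-upTo⁺ x<p)))
        (x , y , refl , on , ns)

      Unique-E : Unique E
      Unique-E = All.tabulate ∞∉affinePts ∷ Unique.filter⁺ _ (Unique-rows (upTo p) (Unique.upTo⁺ p))
        where
        ∞∉affinePts : ∀ {P} → P ∈ affinePts → ∞ ≢ P
        ∞∉affinePts P∈ ∞≡P with ∈affinePts⁻ P∈
        ... | _ , _ , refl , _ with () ← ∞≡P
        Unique-rows : ∀ xs → Unique xs → Unique (concatMap row xs)
        Unique-rows []       _              = []
        Unique-rows (x ∷ xs) (x∉xs ∷ uniq) = Unique.++⁺ (Unique.map⁺ aff-inj₂ (Unique.upTo⁺ p)) (Unique-rows xs uniq) disjoint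
          where
          disjoint : ∀ {P} → ¬ (P ∈ row x × P ∈ concatMap row xs)
          disjoint (P∈row , P∈rows) with ∈-map⁻ (aff x) P∈row | find (∈-concatMap⁻ row {xs = xs} P∈rows)
          ... | _ , _ , refl | x′ , x′∈ , P∈row′ with ∈-map⁻ (aff x′) P∈row′
          ... | _ , _ , x≡x′ = All.lookup x∉xs x′∈ (aff-inj₁ x≡x′)

      φ∈E : ∀ {t} → t ∈ units → φ t ∈ E
      φ∈E {t} t∈ with t ≟ 1
      ... | yes refl = here refl
      ... | no t≢1   = there (∈affinePts⁺ (⊗<p u u) (⊗<p u ((u ⊗ u) ⊕ a)) on-curve nonsingular′)
        where
        u = U t
        on-curve : OnCurve (X u) (Y u)
        on-curve = ≈⇒≡ (⊗<p (Y u) (Y u)) (⊗<p (X u) ((X u ⊕ a) ⊗ (X u ⊕ a)))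
          (solve 2 (λ u a → (u :* ((u :* u) :+ a)) :* (u :* ((u :* u) :+ a)) := (u :* u) :* (((u :* u) :+ a) :* ((u :* u) :+ a)))
                 (λ _ → refl) (u ∷ a ∷ []))
        nonsingular′ : ¬ Singular (X u) (Y u)
        nonsingular′ sing = nonsingular (units-<p t∈) t≢1 (proj₁ (∈units⁻ t∈))
          (trans (⊕-cong (cong (_% p) (aff-inj₁ sing)) (≈-refl {a})) (solve 1 (λ a → (:- a) :+ a := :0) (λ _ → refl) (a ∷ [])))

      -- The inverse of φ: a point (x, y) ↦ u = y/(x + a) ↦ t = (u + c)/(u - c).
      ψ : Pt → ℕ
      ψ ∞         = 1
      ψ (aff x y) = (u ⊕ c) ⊘ (u ⊖ c)
        where u = y ⊘ (x ⊕ a)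

      module AffinePoint {x y} (x<p : x < p) (y<p : y < p) (on : OnCurve x y) (ns : ¬ Singular x y) where

        private
          d = x ⊕ a
          u = y ⊘ d
          t = ψ (aff x y)

        d≉0 : d ≉ 0
        d≉0 d≈0 = ns (cong₂ aff x≡-a y≡0)
          where
          y²≈0 : y ⊗ y ≈ 0
          y²≈0 = trans (cong (_% p) on) (⊗-≈0ʳ x (⊗-≈0ˡ d d≈0))
          y≡0 : y ≡ 0
          y≡0 = ≈⇒≡ y<p 0<p (Sum.[ id , id ]′ (⊗≈0⇒ y²≈0))
          x≡-a : x ≡ neg a
          x≡-a = ≈⇒≡ x<p (neg<p a) (trans (solve 2 (λ x a → x := (x :+ a) :- a) (λ _ → refl) (x ∷ a ∷ []))
            (trans (⊖-cong d≈0 (≈-refl {a})) (solve 1 (λ a → :0 :- a := :- a) (λ _ → refl) (a ∷ []))))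

        u·d≈y : u ⊗ d ≈ y
        u·d≈y = ⊘-⊗ d≉0

        Xu≈x : X u ≈ x
        Xu≈x = ⊗-cancelʳ (⊗-≉0 d≉0 d≉0) (trans
          (solve 2 (λ u d → (u :* u) :* (d :* d) := (u :* d) :* (u :* d)) (λ _ → refl) (u ∷ d ∷ []))
          (trans (⊗-cong u·d≈y u·d≈y) (cong (_% p) on)))

        Yu≈y : Y u ≈ y
        Yu≈y = trans (⊗-cong (≈-refl {u}) (⊕-cong Xu≈x (≈-refl {a}))) u·d≈y

        u-c≉0 : u ⊖ c ≉ 0
        u-c≉0 = d≉0 ∘ trans (trans (⊕-cong (sym Xu≈x) (≈-refl {a})) (X⊕a≈[u-c][u+c] u)) ∘ ⊗-≈0ˡ (u ⊕ c)

        u+c≉0 : u ⊕ c ≉ 0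
        u+c≉0 = d≉0 ∘ trans (trans (⊕-cong (sym Xu≈x) (≈-refl {a})) (X⊕a≈[u-c][u+c] u)) ∘ ⊗-≈0ʳ (u ⊖ c)

        t·[u-c]≈u+c : t ⊗ (u ⊖ c) ≈ u ⊕ c
        t·[u-c]≈u+c = ⊘-⊗ u-c≉0

        t≢0 : t ≢ 0
        t≢0 t≡0 = u+c≉0 (trans (sym t·[u-c]≈u+c) (⊗-≈0ˡ (u ⊖ c) (cong (_% p) t≡0)))

        t≢1 : t ≢ 1
        t≢1 t≡1 = 2c≉0 (trans (solve 2 (λ u c → :2 :* c := (u :+ c) :- (:1 :* (u :- c))) (λ _ → refl) (u ∷ c ∷ []))
                           (≈⇒⊖≈0 (trans (sym t·[u-c]≈u+c) (⊗-cong (cong (_% p) t≡1) (≈-refl {u ⊖ c})))))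

        t<p : t < p
        t<p = ⊗<p (u ⊕ c) (inv (u ⊖ c))

        t∈units : t ∈ units
        t∈units = ∈units⁺ t≢0 t<p

        Ut≈u : U t ≈ u
        Ut≈u = ⊗-cancelʳ (t-1≉0 t<p t≢1) (trans (U-def t<p t≢1) (sym (⊖≈0⇒≈ (trans
          (solve 3 (λ u c t → (u :* (t :- :1)) :- (c :* (t :+ :1)) := (t :* (u :- c)) :- (u :+ c)) (λ _ → refl) (u ∷ c ∷ t ∷ []))
          (≈⇒⊖≈0 t·[u-c]≈u+c)))))

        φψ≡ : φ t ≡ aff x y
        φψ≡ = trans (φ-≢1 t≢1) (sym (aff≡point (U t) x<p y<p (trans (sym Xu≈x) (X-cong (sym Ut≈u))) (trans (sym Yu≈y) (Y-cong (sym Ut≈u)))))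

      ψ∘φ : ∀ {t} → t ∈ units → ψ (φ t) ≡ t
      ψ∘φ {t} t∈ with t ≟ 1
      ... | yes refl = refl
      ... | no t≢1   = sym (≈⇒≡ t<p (⊗<p (u ⊕ c) (inv (u ⊖ c))) (⊗≈⇒≈⊘ u-c≉0 t·[u-c]≈u+c))
        where
        t<p = units-<p t∈
        v = U t
        u = Y v ⊘ (X v ⊕ a)
        v≉±c : X v ⊕ a ≉ 0
        v≉±c = nonsingular t<p t≢1 (proj₁ (∈units⁻ t∈))
        u≈v : u ≈ v
        u≈v = ⊗-cancelʳ v≉±c (⊘-⊗ v≉±c)
        u-c≉0 : u ⊖ c ≉ 0
        u-c≉0 = U≉c t<p t≢1 ∘ trans (⊖-cong (sym u≈v) (≈-refl {c}))
        t·[u-c]≈u+c : t ⊗ (u ⊖ c) ≈ u ⊕ c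
        t·[u-c]≈u+c = trans (⊗-cong (≈-refl {t}) (⊖-cong u≈v (≈-refl {c}))) (trans (⊖≈0⇒≈ (trans
          (solve 3 (λ v c t → (t :* (v :- c)) :- (v :+ c) := (v :* (t :- :1)) :- (c :* (t :+ :1))) (λ _ → refl) (v ∷ c ∷ t ∷ []))
          (≈⇒⊖≈0 (U-def t<p t≢1)))) (⊕-cong (sym u≈v) (≈-refl {c})))

      units↭E : map φ units ↭ E
      units↭E = Unique∧⊆∧length≥⇒↭ (Unique-map-on φ φ-injective Unique-units) φ[units]⊆E
                                  (Unique∧⊆⇒length≤ Unique-E E⊆φ[units])
        where
        φ-injective : ∀ {s t} → s ∈ units → t ∈ units → φ s ≡ φ t → s ≡ t
        φ-injective s∈ t∈ φs≡φt = trans (sym (ψ∘φ s∈)) (trans (cong ψ φs≡φt) (ψ∘φ t∈))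
        φ[units]⊆E : map φ units ⊆ E
        φ[units]⊆E P∈ with ∈-map⁻ φ P∈
        ... | t , t∈ , refl = φ∈E t∈
        E⊆φ[units] : E ⊆ map φ units
        E⊆φ[units] (here refl) = ∈-map⁺ φ 1∈units
        E⊆φ[units] (there P∈) with ∈affinePts⁻ P∈
        ... | x , y , refl , x<p , y<p , on , ns =
          subst (_∈ map φ units) (AffinePoint.φψ≡ x<p y<p on ns) (∈-map⁺ φ (AffinePoint.t∈units x<p y<p on ns))

      length-E : length E ≡ p ∸ 1
      length-E = trans (sym (↭-length units↭E)) (trans (length-map φ units) length-units)

      countEvent≡ : ∀ e m → p ∸ 1 ≡ 2 ^ e * m → 1 ≤ e → 0 < m → countEvent e m ≡ (p ∸ 1) ∸ 2 * m
      countEvent≡ e m p-1≡2ᵉm e≥1 m>0 = begin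
        length (filter (event? e m) E)                 ≡⟨ length-filter-↭ (event? e m) units↭E ⟨
        length (filter (event? e m) (map φ units))     ≡⟨ length-filter-map (event? e m) φ units ⟩
        length (filter (event? e m ∘ φ) units)         ≡⟨ length-filter-cong (event? e m ∘ φ) (¬? ∘ root?) units
                                                            (λ t∈ ev → Event⇒τ₁≉1 t∈ ev ∘ cong (_% p))
                                                            (λ t∈ ¬root → τ₁≉1⇒Event t∈ (¬root ∘ ≈⇒≡ (^ₚ<p _ (2 * m)) 1<p)) ⟩
        length nonroots                                ≡⟨ ℕ.m+n∸m≡n (length roots) (length nonroots) ⟨
        (length roots + length nonroots) ∸ length roots ≡⟨ cong₂ _∸_ #roots+#nonroots #roots≡2m ⟩
        (p ∸ 1) ∸ 2 * m                                ∎
        where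
        open ≡-Reasoning
        open Event e m p-1≡2ᵉm e≥1
        root? : Decidable ((2 * m) IsRootOfUnity_)
        root? = (2 * m) IsRootOfUnity?_
        roots    = filter root? units
        nonroots = filter (¬? ∘ root?) units

        #roots+#nonroots : length roots + length nonroots ≡ p ∸ 1
        #roots+#nonroots = trans (length-filter+length-filter-¬ root? units) length-units

        #roots≡2m : length roots ≡ 2 * m
        #roots≡2m = #rootsOfUnity (2 * m) (2 ^ (e ∸ 1)) (ℕ.*-monoʳ-< 2 m>0) (ℕ.m^n>0 2 (e ∸ 1))
                      (trans (2m·2ᵉ⁻¹≡2ᵉm e≥1) (sym p-1≡2ᵉm))
          where
          2m·2ᵉ⁻¹≡2ᵉm : ∀ {e} → 1 ≤ e → 2 * m * 2 ^ (e ∸ 1) ≡ 2 ^ e * m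
          2m·2ᵉ⁻¹≡2ᵉm {suc e} _ = lemma (2 ^ e) m
            where
            lemma : ∀ x m → 2 * m * x ≡ 2 * x * m
            lemma = ℕ-solve-∀

p∸1≡[p/8]*8 : ∀ {p} → p % 8 ≡ 1 → p ∸ 1 ≡ p / 8 * 8
p∸1≡[p/8]*8 {p} p%8≡1 = cong (_∸ 1) (trans (m≡m%n+[m/n]*n p 8) (cong (_+ p / 8 * 8) p%8≡1))

even≢odd : ∀ {m} k → m ≡ k * 2 → m % 2 ≢ 1
even≢odd {m} k refl m%2≡1 = ℕ.0≢1+n (trans (sym (m*n%n≡0 k 2)) m%2≡1)

[MK∸M]K≡[K∸1][MK] : ∀ M K → (M * K ∸ M) * K ≡ (K ∸ 1) * (M * K)
[MK∸M]K≡[K∸1][MK] M K = begin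
  (M * K ∸ M) * K         ≡⟨ ℕ.*-distribʳ-∸ K (M * K) M ⟩
  M * K * K ∸ M * K       ≡⟨ cong₂ _∸_ (ℕ.*-comm (M * K) K) (sym (ℕ.*-identityˡ (M * K))) ⟩
  K * (M * K) ∸ 1 * (M * K) ≡⟨ ℕ.*-distribʳ-∸ (M * K) K 1 ⟨
  (K ∸ 1) * (M * K)       ∎
  where open ≡-Reasoning

odd⇒>0 : ∀ {m} → m % 2 ≡ 1 → 0 < m
odd⇒>0 {suc _} _ = z<s

2^[2+e]*m≡2m*2^[1+e] : ∀ e m → 2 ^ (2 + e) * m ≡ 2 * m * 2 ^ (1 + e)
2^[2+e]*m≡2m*2^[1+e] e m = lemma (2 ^ e) m
  where
  lemma : ∀ x m → 2 * (2 * x) * m ≡ 2 * m * (2 * x)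
  lemma = ℕ-solve-∀

2^[2+e]*m≡4*2^e*m : ∀ e m → 2 ^ (2 + e) * m ≡ 4 * (2 ^ e * m)
2^[2+e]*m≡4*2^e*m e m = lemma (2 ^ e) m
  where
  lemma : ∀ x m → 2 * (2 * x) * m ≡ 4 * (x * m)
  lemma = ℕ-solve-∀

prime∧%8≡1⇒2<p : ∀ {p} → Prime p → p % 8 ≡ 1 → 2 < p
prime∧%8≡1⇒2<p {0}           p-prime _ = ⊥-elim (¬prime[0] p-prime)
prime∧%8≡1⇒2<p {1}           p-prime _ = ⊥-elim (¬prime[1] p-prime)
prime∧%8≡1⇒2<p {suc (suc (suc _))} _ _ = s≤s (s≤s (s≤s z≤n))

2≤e : ∀ {p e m} → p % 8 ≡ 1 → p ∸ 1 ≡ 2 ^ e * m → m % 2 ≡ 1 → ∃ λ e′ → e ≡ 2 + e′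
2≤e {p} {0}           {m} p%8≡1 p-1≡m m%2≡1 = ⊥-elim (even≢odd (p / 8 * 4) (begin
  m                  ≡⟨ ℕ.+-identityʳ m ⟨
  2 ^ 0 * m          ≡⟨ p-1≡m ⟨
  p ∸ 1              ≡⟨ p∸1≡[p/8]*8 {p} p%8≡1 ⟩
  p / 8 * 8          ≡⟨ ℕ.*-assoc (p / 8) 4 2 ⟨
  p / 8 * 4 * 2      ∎) m%2≡1)
  where open ≡-Reasoning
2≤e {p} {1}           {m} p%8≡1 p-1≡2m m%2≡1 = ⊥-elim (even≢odd (p / 8 * 2) (ℕ.*-cancelˡ-≡ m (p / 8 * 2 * 2) 2 (begin
  2 * m              ≡⟨ p-1≡2m ⟨
  p ∸ 1              ≡⟨ p∸1≡[p/8]*8 {p} p%8≡1 ⟩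
  p / 8 * 8          ≡⟨ lemma (p / 8) ⟩
  2 * (p / 8 * 2 * 2) ∎)) m%2≡1)
  where
  open ≡-Reasoning
  lemma : ∀ q → q * 8 ≡ 2 * (q * 2 * 2)
  lemma = ℕ-solve-∀
2≤e {e = suc (suc e′)} _ _ _ = e′ , refl

mainTheorem2 : (p e m a : ℕ) → .{{_ : NonZero p}} → Prime p → p % 8 ≡ 1
    → p ∸ 1 ≡ (2 ^ e) * m → m % 2 ≡ 1
    → a < p → a ≢ 0 → (∃ λ b → b < p × (b * b) % p ≡ a)
    → Curve.countEvent p a e m * (2 ^ (e ∸ 1))
    ≡ ((2 ^ (e ∸ 1)) ∸ 1) * length (Curve.E p a)
mainTheorem2 p e m a p-prime p%8≡1 p-1≡2ᵉm m%2≡1 a<p a≢0 (b , _ , b²≡a) with 2≤e {p} {e} {m} p%8≡1 p-1≡2ᵉm m%2≡1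
... | e′ , refl = begin
  countEvent e m * K              ≡⟨ cong (_* K) (countEvent≡ e m p-1≡2ᵉm (s≤s z≤n) m>0) ⟩
  ((p ∸ 1) ∸ 2 * m) * K           ≡⟨ cong (λ n → (n ∸ 2 * m) * K) p-1≡2mK ⟩
  (2 * m * K ∸ 2 * m) * K         ≡⟨ [MK∸M]K≡[K∸1][MK] (2 * m) K ⟩
  (K ∸ 1) * (2 * m * K)           ≡⟨ cong ((K ∸ 1) *_) (trans (sym p-1≡2mK) (sym length-E)) ⟩
  (K ∸ 1) * length E              ∎
  where
  open ≡-Reasoning
  open Development p a
  open PrimeField p-prime
  K = 2 ^ suc e′
  m>0 : 0 < m
  m>0 = odd⇒>0 m%2≡1
  p-1≡2mK : p ∸ 1 ≡ 2 * m * K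
  p-1≡2mK = trans p-1≡2ᵉm (2^[2+e]*m≡2m*2^[1+e] e′ m)
  √[-b²] : ∃ λ c → c ⊗ c ≈ neg (b ⊗ b)
  √[-b²] = ∃√[-b²] b (2 ^ e′ * m) (ℕ.*-mono-≤ (ℕ.m^n>0 2 e′) m>0) (trans (sym (2^[2+e]*m≡4*2^e*m e′ m)) (sym p-1≡2ᵉm))
  c = proj₁ √[-b²]
  c²≈-a : c ⊗ c ≈ neg a
  c²≈-a = trans (proj₂ √[-b²]) (neg-cong (cong (_% p) b²≡a))
  open SplitNode (prime∧%8≡1⇒2<p p-prime p%8≡1) c c²≈-a (≢0⇒≉0 a<p a≢0)
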